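{- Let $G=K_s^t$ with $2\leq t\leq s$ and $n=s+t$, and let $P_D(\lambda)=\det(\lambda I-D(G))$. If $s\geq t+1$, then $$P_{D}(\lambda)=(\lambda+1)^{s-t-1}(\lambda+2-\sqrt{2})^{t-1}(\lambda+2+\sqrt{2})^{t-1}\left[\lambda^{3}+(5-s-3t)\lambda^{2}+(6-4s-2t-st)\lambda+2-2s-st\right].$$ If $s=t$, then $$P_{D}(\lambda)=(\lambda+2-\sqrt{2})^{t-1}(\lambda+2+\sqrt{2})^{t-1}\left[\lambda^{2}+(4-4t)\lambda+2-2t-t^{2}\right].$$
   Context: All graphs are simple, undirected and connected. $D(G)$ is the distance matrix of $G$, whose $(i,j)$ entry is the shortest-path distance between the $i$-th and $j$-th vertices. For $2\leq t\leq s$, $K_s^t$ is the graph on $n=s+t$ vertices obtained from the complete graph $K_s$ by attaching a pendant edge (to a new vertex) at each of $t$ distinct vertices of $K_s$. -}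

module Defs where

open import Level using (Level)
open import Data.Bool.Base using (Bool; true; false; _∧_; _∨_; if_then_else_; not)
open import Data.Nat.Base as ℕ using (ℕ; zero; suc; _<ᵇ_; _≤ᵇ_; _≡ᵇ_; _∸_)
open import Data.Fin.Base using (Fin; zero; suc; toℕ; punchIn)
open import Data.Fin.Properties using (_≟_)
open import Data.List.Base using (allFin)
open import Data.Bool.ListAction using (any)
open import Relation.Nullary.Decidable.Core using (isYes)
open import Algebra.Bundles using (CommutativeRing)

Adj : ℕ → Set
Adj n = Fin n → Fin n → Bool

reach : ∀ {n} → Adj n → ℕ → Fin n → Fin n → Bool
reach adj zero    i j = isYes (i ≟ j)
reach {n} adj (suc k) i j =
  reach adj k i j ∨ any (λ m → reach adj k i m ∧ adj m j) (allFin n)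

-- Shortest-path distance: the least k with a walk of length ≤ k from i to j.
-- (For a connected graph on n vertices this least k is < n, so the search
-- over k = 0 … n always succeeds.)
distAux : ∀ {n} → Adj n → Fin n → Fin n → ℕ → ℕ → ℕ
distAux adj i j zero    k = k
distAux adj i j (suc f) k =
  if reach adj k i j then k else distAux adj i j f (suc k)

dist : ∀ {n} → Adj n → Fin n → Fin n → ℕ
dist {n} adj i j = distAux adj i j n 0

-- The graph K_s^t on n = s + t vertices: vertices 0 … s-1 form K_s, and
-- vertex s + i (i < t) is a pendant vertex attached to vertex i.

KAdj : (s t : ℕ) → Adj (s ℕ.+ t)
KAdj s t a b =
  ((toℕ a <ᵇ s) ∧ (toℕ b <ᵇ s) ∧ not (toℕ a ≡ᵇ toℕ b))
  ∨ ((s ≤ᵇ toℕ a) ∧ (toℕ b ≡ᵇ (toℕ a ∸ s)))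
  ∨ ((s ≤ᵇ toℕ b) ∧ (toℕ a ≡ᵇ (toℕ b ∸ s)))

DK : (s t : ℕ) → Fin (s ℕ.+ t) → Fin (s ℕ.+ t) → ℕ
DK s t = dist (KAdj s t)

module RingDefs {c ℓ : Level} (R : CommutativeRing c ℓ) where
  open CommutativeRing R using (Carrier; _+_; _*_; _-_; 0#; 1#)

  fromℕ : ℕ → Carrier
  fromℕ zero    = 0#
  fromℕ (suc k) = 1# + fromℕ k

  _^_ : Carrier → ℕ → Carrier
  x ^ zero  = 1#
  x ^ suc k = x * (x ^ k)

  altSum : ∀ {n} → (Fin n → Carrier) → Carrier
  altSum {zero}  f = 0#
  altSum {suc n} f = f zero - altSum (λ j → f (suc j))

  det : ∀ {n} → (Fin n → Fin n → Carrier) → Carrier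
  det {zero}  M = 1#
  det {suc n} M = altSum (λ j → M zero j * det (λ a b → M (suc a) (punchIn j b)))

  charMat : ∀ {n} → (Fin n → Fin n → ℕ) → Carrier → Fin n → Fin n → Carrier
  charMat D x i j = (if isYes (i ≟ j) then x else 0#) - fromℕ (D i j)

  charPoly : ∀ {n} → (Fin n → Fin n → ℕ) → Carrier → Carrier
  charPoly D x = det (charMat D x)

module Submission where

-- Listing the vertices as anchor–pendant pairs followed by the s − t clique
-- vertices without pendant turns x I − D(K_s^t) into the quotient matrix of
-- x I − D for the partition into singletons.  Merging two classes of the same
-- type by row and column operations leaves a quotient matrix again and costs
-- a factor x² + 4x + 2 = (x + 2 − √2)(x + 2 + √2) for two pair classes and
-- x + 1 for two pendant-free vertices.  After merging all pairs, and all
-- pendant-free vertices if s > t, a 2 × 2 (s = t) or 3 × 3 quotient matrix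
-- remains, whose determinant is the quadratic (cubic) factor.

open import Defs
open import Level using (Level)
open import Data.Nat.Base using (ℕ; _≤_; _∸_; _≡ᵇ_) renaming (_+_ to _+ℕ_; _*_ to _*ℕ_)
open import Data.Product.Base using (_×_)
open import Relation.Binary.PropositionalEquality using (_≡_)
open import Algebra.Bundles using (CommutativeRing)

open import Level using (_⊔_)
open import Data.Nat.Base as ℕ using (zero; suc; _<_; _<ᵇ_; s≤s; z≤n)
import Data.Nat.Properties as ℕ
open import Data.Bool.Base using (true; false; if_then_else_)
open import Data.Fin.Base using (Fin; zero; suc; toℕ; punchIn)
open import Data.Fin.Properties using (_≟_; toℕ-injective)
open import Data.List.Base using (List; []; _∷_; _++_; replicate)
open import Data.Product.Base using (Σ-syntax; _,_; ∃)
open import Relation.Nullary using (yes; no)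
open import Relation.Nullary.Decidable.Core using (isYes)
import Relation.Binary.PropositionalEquality as ≡
open ≡ using (_≢_)

module IntegerCoefficients {c ℓ : Level} (R : CommutativeRing c ℓ) where
  open import Algebra.Bundles using (RawRing)
  open import Data.Integer.Base as ℤ using (ℤ; +_; -[1+_]; _⊖_)
  import Data.Integer.Properties as ℤ
  import Data.Sign.Base as Sign
  open import Data.Maybe.Base using (Maybe; just; nothing)
  import Algebra.Solver.Ring.AlmostCommutativeRing as ACR
  open CommutativeRing R
  open RingDefs R
  open import Algebra.Properties.Ring ring using (-‿distribˡ-*; -‿distribʳ-*; -‿involutive; -0#≈0#; -‿+-comm)
  open import Algebra.Properties.Semiring.Mult semiring using (×-homo-+; ×1-homo-*) renaming (_×_ to _×ᵤ_)
  open import Algebra.Properties.Monoid.Mult.TCOptimised +-monoid using (×ᵤ≈×) renaming (_×_ to _×′_)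
  open import Algebra.Solver.Ring.NaturalCoefficients.Default commutativeSemiring as ℕ-Solver using ()
  open import Relation.Binary.Reasoning.Setoid setoid

  fromℕ≡×1# : ∀ n → fromℕ n ≡.≡ n ×ᵤ 1#
  fromℕ≡×1# zero    = ≡.refl
  fromℕ≡×1# (suc n) = ≡.cong (λ z → 1# + z) (fromℕ≡×1# n)

  fromℕ-homo-+ : ∀ m n → fromℕ (m +ℕ n) ≈ fromℕ m + fromℕ n
  fromℕ-homo-+ m n rewrite fromℕ≡×1# (m +ℕ n) | fromℕ≡×1# m | fromℕ≡×1# n = ×-homo-+ 1# m n

  fromℕ-homo-* : ∀ m n → fromℕ (m *ℕ n) ≈ fromℕ m * fromℕ n
  fromℕ-homo-* m n rewrite fromℕ≡×1# (m *ℕ n) | fromℕ≡×1# m | fromℕ≡×1# n = ×1-homo-* m n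

  fromℤ : ℤ → Carrier
  fromℤ (+ n)    = fromℕ n
  fromℤ -[1+ n ] = - fromℕ (suc n)

  fromℤ-⊖ : ∀ m n → fromℤ (m ⊖ n) ≈ fromℕ m - fromℕ n
  fromℤ-⊖ zero    zero    = sym (-‿inverseʳ 0#)
  fromℤ-⊖ zero    (suc n) = sym (+-identityˡ _)
  fromℤ-⊖ (suc m) zero    = sym (trans (+-congˡ -0#≈0#) (+-identityʳ _))
  fromℤ-⊖ (suc m) (suc n) = begin
    fromℤ (suc m ⊖ suc n)             ≡⟨ ≡.cong fromℤ (ℤ.[1+m]⊖[1+n]≡m⊖n m n) ⟩
    fromℤ (m ⊖ n)                     ≈⟨ fromℤ-⊖ m n ⟩
    fromℕ m - fromℕ n                 ≈⟨ shift (fromℕ m) (fromℕ n) ⟩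
    (1# + fromℕ m) - (1# + fromℕ n)   ∎
    where
    open ℕ-Solver
    shift : ∀ a b → a - b ≈ (1# + a) - (1# + b)
    shift a b = begin
      a - b                      ≈⟨ +-congˡ (sym (+-identityˡ (- b))) ⟩
      a + (0# - b)               ≈⟨ +-congˡ (+-congʳ (sym (-‿inverseʳ 1#))) ⟩
      a + ((1# - 1#) - b)        ≈⟨ +-congˡ (+-assoc 1# (- 1#) (- b)) ⟩
      a + (1# + (- 1# - b))      ≈⟨ +-congˡ (+-congˡ (-‿+-comm 1# b)) ⟩
      a + (1# - (1# + b))        ≈⟨ solve 3 (λ a o d → a :+ (o :+ d) := (o :+ a) :+ d) refl a 1# (- (1# + b)) ⟩
      (1# + a) - (1# + b)        ∎

  fromℤ-+◃ : ∀ n → fromℤ (Sign.+ ℤ.◃ n) ≈ fromℕ n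
  fromℤ-+◃ zero    = refl
  fromℤ-+◃ (suc n) = refl

  fromℤ-−◃ : ∀ n → fromℤ (Sign.- ℤ.◃ n) ≈ - fromℕ n
  fromℤ-−◃ zero    = sym -0#≈0#
  fromℤ-−◃ (suc n) = refl

  fromℤ-homo-+ : ∀ i j → fromℤ (i ℤ.+ j) ≈ fromℤ i + fromℤ j
  fromℤ-homo-+ (+ m)    (+ n)    = fromℕ-homo-+ m n
  fromℤ-homo-+ (+ m)    -[1+ n ] = fromℤ-⊖ m (suc n)
  fromℤ-homo-+ -[1+ m ] (+ n)    = trans (fromℤ-⊖ n (suc m)) (+-comm _ _)
  fromℤ-homo-+ -[1+ m ] -[1+ n ] = begin
    - (1# + (1# + fromℕ (m +ℕ n)))        ≈⟨ -‿cong (+-congˡ (+-congˡ (fromℕ-homo-+ m n))) ⟩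
    - (1# + (1# + (fromℕ m + fromℕ n)))    ≈⟨ -‿cong (regroup (fromℕ m) (fromℕ n)) ⟩
    - ((1# + fromℕ m) + (1# + fromℕ n))    ≈⟨ -‿+-comm _ _ ⟨
    - (1# + fromℕ m) - (1# + fromℕ n)      ∎
    where
    open ℕ-Solver
    regroup : ∀ a b → 1# + (1# + (a + b)) ≈ (1# + a) + (1# + b)
    regroup = solve 2 (λ a b → con 1 :+ (con 1 :+ (a :+ b)) := (con 1 :+ a) :+ (con 1 :+ b)) refl

  fromℤ-homo-* : ∀ i j → fromℤ (i ℤ.* j) ≈ fromℤ i * fromℤ j
  fromℤ-homo-* (+ m)    (+ n)    = trans (fromℤ-+◃ (m *ℕ n)) (fromℕ-homo-* m n)
  fromℤ-homo-* (+ m)    -[1+ n ] =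
    trans (fromℤ-−◃ (m *ℕ suc n)) (trans (-‿cong (fromℕ-homo-* m (suc n))) (-‿distribʳ-* _ _))
  fromℤ-homo-* -[1+ m ] (+ n)    =
    trans (fromℤ-−◃ (suc m *ℕ n)) (trans (-‿cong (fromℕ-homo-* (suc m) n)) (-‿distribˡ-* _ _))
  fromℤ-homo-* -[1+ m ] -[1+ n ] = begin
    fromℤ (Sign.+ ℤ.◃ (suc m *ℕ suc n))      ≈⟨ fromℤ-+◃ (suc m *ℕ suc n) ⟩
    fromℕ (suc m *ℕ suc n)                   ≈⟨ fromℕ-homo-* (suc m) (suc n) ⟩
    fromℕ (suc m) * fromℕ (suc n)             ≈⟨ -‿involutive _ ⟨
    - - (fromℕ (suc m) * fromℕ (suc n))       ≈⟨ -‿cong (-‿distribʳ-* _ _) ⟩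
    - (fromℕ (suc m) * - fromℕ (suc n))       ≈⟨ -‿distribˡ-* _ _ ⟩
    - fromℕ (suc m) * - fromℕ (suc n)         ∎

  fromℤ-homo-- : ∀ i → fromℤ (ℤ.- i) ≈ - fromℤ i
  fromℤ-homo-- (+ zero)  = sym -0#≈0#
  fromℤ-homo-- (+ suc n) = refl
  fromℤ-homo-- -[1+ n ]  = sym (-‿involutive _)

  -- The solver interprets constants by this variant of fromℤ, which sends
  -- + 0 and + 1 to 0# and 1# on the nose, so that solved equations can be
  -- stated with 0# and 1#.
  ⟦_⟧ℤ : ℤ → Carrier
  ⟦ + n ⟧ℤ    = n ×′ 1#
  ⟦ -[1+ n ] ⟧ℤ = - (suc n ×′ 1#)

  fromℤ≈⟦⟧ℤ : ∀ i → fromℤ i ≈ ⟦ i ⟧ℤ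
  fromℤ≈⟦⟧ℤ (+ n)    = trans (reflexive (fromℕ≡×1# n)) (×ᵤ≈× n 1#)
  fromℤ≈⟦⟧ℤ -[1+ n ] = -‿cong (trans (reflexive (fromℕ≡×1# (suc n))) (×ᵤ≈× (suc n) 1#))

  ℤ-rawRing : RawRing _ _
  ℤ-rawRing = CommutativeRing.rawRing ℤ.+-*-commutativeRing

  ⟦⟧ℤ-morphism : ℤ-rawRing ACR.-Raw-AlmostCommutative⟶ ACR.fromCommutativeRing R
  ⟦⟧ℤ-morphism = record
    { ⟦_⟧    = ⟦_⟧ℤ
    ; +-homo = λ i j → via (i ℤ.+ j) (fromℤ-homo-+ i j) (+-cong (fromℤ≈⟦⟧ℤ i) (fromℤ≈⟦⟧ℤ j))
    ; *-homo = λ i j → via (i ℤ.* j) (fromℤ-homo-* i j) (*-cong (fromℤ≈⟦⟧ℤ i) (fromℤ≈⟦⟧ℤ j))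
    ; -‿homo = λ i → via (ℤ.- i) (fromℤ-homo-- i) (-‿cong (fromℤ≈⟦⟧ℤ i))
    ; 0-homo = refl
    ; 1-homo = refl
    }
    where
    via : ∀ k {a b} → fromℤ k ≈ a → a ≈ b → ⟦ k ⟧ℤ ≈ b
    via k p q = trans (sym (fromℤ≈⟦⟧ℤ k)) (trans p q)

  ℤ-equal? : ∀ i j → Maybe (⟦ i ⟧ℤ ≈ ⟦ j ⟧ℤ)
  ℤ-equal? i j with i ℤ.≟ j
  ... | yes ≡.refl = just refl
  ... | no _       = nothing

  open import Algebra.Solver.Ring ℤ-rawRing (ACR.fromCommutativeRing R) ⟦⟧ℤ-morphism ℤ-equal? public

pattern 0F = zero
pattern 1F = suc zero
pattern 2F = suc (suc zero)
pattern 3F = suc (suc (suc zero))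

punchInℕ : ℕ → ℕ → ℕ
punchInℕ k b = if b <ᵇ k then b else suc b

toℕ-punchIn : ∀ {n} (j : Fin (suc n)) b → toℕ (punchIn j b) ≡ punchInℕ (toℕ j) (toℕ b)
toℕ-punchIn zero    b       = ≡.refl
toℕ-punchIn (suc j) zero    = ≡.refl
toℕ-punchIn (suc j) (suc b) with toℕ b <ᵇ toℕ j | toℕ-punchIn j b
... | true  | eq = ≡.cong suc eq
... | false | eq = ≡.cong suc eq

cycleℕ : ℕ → ℕ → ℕ
cycleℕ k zero    = k
cycleℕ k (suc a) = punchInℕ k a

liftℕ : (ℕ → ℕ) → ℕ → ℕ
liftℕ p zero    = zero
liftℕ p (suc a) = suc (p a)


module Determinants {c ℓ : Level} (R : CommutativeRing c ℓ) where
  open import Data.Fin.Properties using (punchInᵢ≢i; suc-injective) renaming (_≟_ to _≟ᶠ_)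
  open import Data.Integer.Base using (+_)
  open import Data.Empty using (⊥-elim)
  open import Function.Base using (_∘_)
  open CommutativeRing R hiding (zero)
  open RingDefs R
  open IntegerCoefficients R
  open import Algebra.Properties.CommutativeSemigroup *-commutativeSemigroup using (x∙yz≈y∙xz)
  open import Relation.Binary.Reasoning.Setoid setoid

  Mat : ℕ → Set c
  Mat n = Fin n → Fin n → Carrier

  minor : ∀ {n} → Fin (suc n) → Fin (suc n) → Mat (suc n) → Mat n
  minor i j M a b = M (punchIn i a) (punchIn j b)

  _ᵀ : ∀ {n} → Mat n → Mat n
  (M ᵀ) i j = M j i

  sign : ℕ → Carrier
  sign zero    = 1#
  sign (suc k) = - sign k

  sign-involutive : ∀ k → sign k * sign k ≈ 1#
  sign-involutive zero    = *-identityˡ 1#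
  sign-involutive (suc k) =
    trans (solve 1 (λ a → (:- a) :* (:- a) := a :* a) refl (sign k)) (sign-involutive k)

  −-cong : ∀ {a b c d} → a ≈ b → c ≈ d → a - c ≈ b - d
  −-cong p q = +-cong p (-‿cong q)

  altSum-cong : ∀ {n} {f g : Fin n → Carrier} → (∀ j → f j ≈ g j) → altSum f ≈ altSum g
  altSum-cong {zero}  e = refl
  altSum-cong {suc n} e = −-cong (e zero) (altSum-cong (λ j → e (suc j)))

  altSum-zero : ∀ {n} {f : Fin n → Carrier} → (∀ j → f j ≈ 0#) → altSum f ≈ 0#
  altSum-zero {zero}  e = refl
  altSum-zero {suc n} e = trans (−-cong (e zero) (altSum-zero (λ j → e (suc j)))) (-‿inverseʳ 0#)

  altSum-homo-− : ∀ {n} (f g : Fin n → Carrier) → altSum (λ j → f j - g j) ≈ altSum f - altSum g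
  altSum-homo-− {zero}  f g = sym (-‿inverseʳ 0#)
  altSum-homo-− {suc n} f g =
    trans (−-cong refl (altSum-homo-− (λ j → f (suc j)) (λ j → g (suc j))))
          (solve 4 (λ a b c d → (a :- b) :- (c :- d) := (a :- c) :- (b :- d)) refl _ _ _ _)

  altSum-homo-+ : ∀ {n} (f g : Fin n → Carrier) → altSum (λ j → f j + g j) ≈ altSum f + altSum g
  altSum-homo-+ {zero}  f g = sym (+-identityʳ 0#)
  altSum-homo-+ {suc n} f g =
    trans (−-cong refl (altSum-homo-+ (λ j → f (suc j)) (λ j → g (suc j))))
          (solve 4 (λ a b c d → (a :+ b) :- (c :+ d) := (a :- c) :+ (b :- d)) refl _ _ _ _)

  altSum-*ˡ : ∀ {n} a (f : Fin n → Carrier) → altSum (λ j → a * f j) ≈ a * altSum f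
  altSum-*ˡ {zero}  a f = sym (zeroʳ a)
  altSum-*ˡ {suc n} a f =
    trans (−-cong refl (altSum-*ˡ a (λ j → f (suc j))))
          (solve 3 (λ a b c → a :* b :- a :* c := a :* (b :- c)) refl a _ _)

  altSum-single : ∀ {n} (f : Fin n → Carrier) i → (∀ j → j ≢ i → f j ≈ 0#) →
                  altSum f ≈ sign (toℕ i) * f i
  altSum-single f zero    e =
    trans (−-cong refl (altSum-zero (λ j → e (suc j) (λ ()))))
          (solve 1 (λ a → a :- con (+ 0) := con (+ 1) :* a) refl (f zero))
  altSum-single f (suc i) e =
    trans (−-cong (e zero (λ ())) (altSum-single (λ j → f (suc j)) i (λ j j≢i → e (suc j) (j≢i ∘ suc-injective))))
          (solve 2 (λ a b → con (+ 0) :- a :* b := (:- a) :* b) refl (sign (toℕ i)) (f (suc i)))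

  altSum-swap : ∀ {m n} (f : Fin m → Fin n → Carrier) →
                altSum (λ i → altSum (f i)) ≈ altSum (λ j → altSum (λ i → f i j))
  altSum-swap {zero} {n} f = sym (altSum-zero {n} (λ _ → refl))
  altSum-swap {suc m} f = begin
    altSum (f zero) - altSum (λ i → altSum (f (suc i)))          ≈⟨ −-cong refl (altSum-swap (λ i → f (suc i))) ⟩
    altSum (f zero) - altSum (λ j → altSum (λ i → f (suc i) j))
      ≈⟨ altSum-homo-− (f zero) (λ j → altSum (λ i → f (suc i) j)) ⟨
    altSum (λ j → f zero j - altSum (λ i → f (suc i) j))         ∎

  -- Deleting positions j and then l from Fin (2 + m) is the same as deleting
  -- punchIn j l and then swapIndex j l.
  swapIndex : ∀ {m} → Fin (suc m) → Fin m → Fin m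
  swapIndex zero    zero    = zero
  swapIndex zero    (suc l) = zero
  swapIndex (suc j) zero    = j
  swapIndex (suc j) (suc l) = suc (swapIndex j l)

  punchIn-swapIndex : ∀ {m} (j : Fin (suc m)) l → punchIn (punchIn j l) (swapIndex j l) ≡ j
  punchIn-swapIndex zero    zero    = ≡.refl
  punchIn-swapIndex zero    (suc l) = ≡.refl
  punchIn-swapIndex (suc j) zero    = ≡.refl
  punchIn-swapIndex (suc j) (suc l) = ≡.cong suc (punchIn-swapIndex j l)

  punchIn-punchIn : ∀ {m} (j : Fin (suc (suc m))) l b →
                    punchIn j (punchIn l b) ≡ punchIn (punchIn j l) (punchIn (swapIndex j l) b)
  punchIn-punchIn zero    zero    b       = ≡.refl
  punchIn-punchIn zero    (suc l) b       = ≡.refl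
  punchIn-punchIn (suc j) zero    b       = ≡.refl
  punchIn-punchIn (suc j) (suc l) zero    = ≡.refl
  punchIn-punchIn (suc j) (suc l) (suc b) = ≡.cong suc (punchIn-punchIn j l b)

  -- The two double alternating sums indexed by (j, l) and (punchIn j l, swapIndex j l)
  -- enumerate the same pairs of distinct positions with opposite signs.
  altSum²-reindex : ∀ m (F G : Fin (suc m) → Fin m → Carrier) →
                    (∀ j l → F j l ≈ G (punchIn j l) (swapIndex j l)) →
                    altSum (λ j → altSum (F j)) ≈ - altSum (λ l → altSum (G l))
  altSum²-reindex zero    F G h = solve 1 (λ z → z :- z := :- (z :- z)) refl 0#
  altSum²-reindex (suc m) F G h = begin
    altSum (F zero) - altSum (λ j → F (suc j) zero - altSum (λ l → F (suc j) (suc l)))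
      ≈⟨ −-cong top (trans (altSum-homo-− (λ j → F (suc j) zero) (λ j → altSum (λ l → F (suc j) (suc l)))) (−-cong left refl)) ⟩
    A - (B - altSum (λ j → altSum (λ l → F (suc j) (suc l))))
      ≈⟨ −-cong refl (−-cong refl (altSum²-reindex m _ (λ j l → G (suc j) (suc l)) (λ j l → h (suc j) (suc l)))) ⟩
    A - (B - - Y)
      ≈⟨ solve 3 (λ a b y → a :- (b :- (:- y)) := :- (b :- (a :- y))) refl A B Y ⟩
    - (B - (A - Y))
      ≈⟨ -‿cong (−-cong refl (altSum-homo-− (λ l → G (suc l) zero) (λ l → altSum (λ j → G (suc l) (suc j))))) ⟨
    - (altSum (G zero) - altSum (λ l → G (suc l) zero - altSum (λ j → G (suc l) (suc j)))) ∎
    where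
    A = altSum (λ l → G (suc l) zero)
    B = altSum (G zero)
    Y = altSum (λ l → altSum (λ j → G (suc l) (suc j)))
    top : altSum (F zero) ≈ A
    top = altSum-cong {f = F zero} {g = λ l → G (suc l) zero} λ { zero → h zero zero ; (suc l) → h zero (suc l) }
    left : altSum (λ j → F (suc j) zero) ≈ B
    left = altSum-cong (λ j → h (suc j) zero)

  altSum²-symmetric : ∀ m (F : Fin (suc m) → Fin m → Carrier) →
                      (∀ j l → F j l ≈ F (punchIn j l) (swapIndex j l)) →
                      altSum (λ j → altSum (F j)) ≈ 0#
  altSum²-symmetric zero    F h = -‿inverseʳ 0#
  altSum²-symmetric (suc m) F h = begin
    altSum (F zero) - altSum (λ j → F (suc j) zero - altSum (λ l → F (suc j) (suc l)))
      ≈⟨ −-cong top (altSum-homo-− (λ j → F (suc j) zero) (λ j → altSum (λ l → F (suc j) (suc l)))) ⟩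
    A - (A - altSum (λ j → altSum (λ l → F (suc j) (suc l))))
      ≈⟨ −-cong refl (−-cong refl (altSum²-symmetric m _ (λ j l → h (suc j) (suc l)))) ⟩
    A - (A - 0#)   ≈⟨ solve 1 (λ a → a :- (a :- con (+ 0)) := con (+ 0)) refl A ⟩
    0#             ∎
    where
    A = altSum (λ l → F (suc l) zero)
    top : altSum (F zero) ≈ A
    top = altSum-cong {f = F zero} {g = λ l → F (suc l) zero} λ { zero → h zero zero ; (suc l) → h zero (suc l) }

  det-cong : ∀ {n} {M N : Mat n} → (∀ i j → M i j ≈ N i j) → det M ≈ det N
  det-cong {zero}  e = refl
  det-cong {suc n} e = altSum-cong (λ j → *-cong (e zero j) (det-cong (λ a b → e (suc a) (punchIn j b))))

  det-expandRow : ∀ {n} (M : Mat (suc n)) k →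
                  det M ≈ sign (toℕ k) * altSum (λ j → M k j * det (minor k j M))
  det-expandRow M zero = sym (*-identityˡ _)
  det-expandRow {suc m} M (suc k) = begin
    altSum (λ j → M zero j * det (minor zero j M))
      ≈⟨ altSum-cong {f = λ j → M zero j * det (minor zero j M)} (λ j → *-congˡ (det-expandRow (minor zero j M) k)) ⟩
    altSum (λ j → M zero j * (ε * altSum (λ l → M (suc k) (punchIn j l) * det (minor k l (minor zero j M)))))
      ≈⟨ altSum-cong (λ j → trans (x∙yz≈y∙xz _ ε _) (*-congˡ (sym
           (altSum-*ˡ (M zero j) (λ l → M (suc k) (punchIn j l) * det (minor k l (minor zero j M))))))) ⟩
    altSum (λ j → ε * altSum (F j))           ≈⟨ altSum-*ˡ ε (λ j → altSum (F j)) ⟩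
    ε * altSum (λ j → altSum (F j))           ≈⟨ *-congˡ (altSum²-reindex (suc m) F G F≈G) ⟩
    ε * - altSum (λ l → altSum (G l))         ≈⟨ -‿distribʳ-* ε _ ⟨
    - (ε * altSum (λ l → altSum (G l)))       ≈⟨ -‿distribˡ-* ε _ ⟩
    - ε * altSum (λ l → altSum (G l))
      ≈⟨ *-congˡ (altSum-cong (λ l → altSum-*ˡ (M (suc k) l) (λ j → M zero (punchIn l j) * det (minor zero j (minor (suc k) l M))))) ⟩
    - ε * altSum (λ l → M (suc k) l * det (minor (suc k) l M)) ∎
    where
    open import Algebra.Properties.Ring ring using (-‿distribˡ-*; -‿distribʳ-*)
    ε = sign (toℕ k)
    F G : Fin (suc (suc m)) → Fin (suc m) → Carrier
    F j l = M zero j * (M (suc k) (punchIn j l) * det (minor k l (minor zero j M)))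
    G l j = M (suc k) l * (M zero (punchIn l j) * det (minor zero j (minor (suc k) l M)))
    F≈G : ∀ j l → F j l ≈ G (punchIn j l) (swapIndex j l)
    F≈G j l = trans (x∙yz≈y∙xz _ _ _) (*-congˡ (*-cong
      (reflexive (≡.cong (M zero) (≡.sym (punchIn-swapIndex j l))))
      (det-cong (λ a b → reflexive (≡.cong (M (suc (punchIn k a))) (punchIn-punchIn j l b))))))

  det-expandCol₀ : ∀ {n} (M : Mat (suc n)) → det M ≈ altSum (λ i → M i zero * det (minor i zero M))
  det-expandCol₀ {zero}  M = refl
  det-expandCol₀ {suc m} M = −-cong refl (begin
    altSum (λ j → M zero (suc j) * det (minor zero (suc j) M))
      ≈⟨ altSum-cong {f = λ j → M zero (suc j) * det (minor zero (suc j) M)} (λ j → *-congˡ (det-expandCol₀ (minor zero (suc j) M))) ⟩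
    altSum (λ j → M zero (suc j) * altSum (λ i → M (suc i) zero * det (C i j)))
      ≈⟨ altSum-cong (λ j → sym (altSum-*ˡ (M zero (suc j)) (λ i → M (suc i) zero * det (C i j)))) ⟩
    altSum (λ j → altSum (λ i → f j i))   ≈⟨ altSum-swap f ⟩
    altSum (λ i → altSum (λ j → f j i))
      ≈⟨ altSum-cong (λ i → trans (altSum-cong (λ j → x∙yz≈y∙xz (M zero (suc j)) (M (suc i) zero) (det (C i j))))
                                  (altSum-*ˡ (M (suc i) zero) (λ j → M zero (suc j) * det (C i j)))) ⟩
    altSum (λ i → M (suc i) zero * altSum (λ j → M zero (suc j) * det (minor zero j (minor (suc i) zero M)))) ∎)
    where
    C : Fin (suc m) → Fin (suc m) → Mat m
    C i j = minor i zero (minor zero (suc j) M)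
    f : Fin (suc m) → Fin (suc m) → Carrier
    f j i = M zero (suc j) * (M (suc i) zero * det (C i j))

  det-ᵀ : ∀ {n} (M : Mat n) → det (M ᵀ) ≈ det M
  det-ᵀ {zero}  M = refl
  det-ᵀ {suc n} M =
    trans (altSum-cong {f = λ j → M j zero * det (minor j zero M ᵀ)} (λ j → *-congˡ (det-ᵀ (minor j zero M))))
          (sym (det-expandCol₀ M))

  det-linearRow : ∀ {n} (M N Q : Mat (suc n)) k a b →
                  (∀ i j → i ≢ k → Q i j ≈ M i j) → (∀ i j → i ≢ k → Q i j ≈ N i j) →
                  (∀ j → Q k j ≈ a * M k j + b * N k j) → det Q ≈ a * det M + b * det N
  det-linearRow M N Q k a b Q≈M Q≈N Qₖ = begin
    det Q                                                         ≈⟨ det-expandRow Q k ⟩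
    ε * altSum (λ j → Q k j * det (minor k j Q))                  ≈⟨ *-congˡ (altSum-cong expand) ⟩
    ε * altSum (λ j → a * (M k j * det (minor k j M)) + b * (N k j * det (minor k j N)))
      ≈⟨ *-congˡ (trans (altSum-homo-+ (λ j → a * (M k j * det (minor k j M))) (λ j → b * (N k j * det (minor k j N))))
                        (+-cong (altSum-*ˡ a (λ j → M k j * det (minor k j M))) (altSum-*ˡ b (λ j → N k j * det (minor k j N))))) ⟩
    ε * (a * SM + b * SN)
      ≈⟨ solve 5 (λ e a b x y → e :* (a :* x :+ b :* y) := a :* (e :* x) :+ b :* (e :* y)) refl ε a b SM SN ⟩
    a * (ε * SM) + b * (ε * SN)
      ≈⟨ +-cong (*-congˡ (det-expandRow M k)) (*-congˡ (det-expandRow N k)) ⟨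
    a * det M + b * det N                                         ∎
    where
    ε = sign (toℕ k)
    SM = altSum (λ j → M k j * det (minor k j M))
    SN = altSum (λ j → N k j * det (minor k j N))
    expand : ∀ j → Q k j * det (minor k j Q) ≈ a * (M k j * det (minor k j M)) + b * (N k j * det (minor k j N))
    expand j = trans (*-cong (Qₖ j) refl) (trans (distribʳ _ _ _) (+-cong
      (trans (*-assoc _ _ _) (*-congˡ (*-congˡ (det-cong (λ x _ → Q≈M _ _ (punchInᵢ≢i k x))))))
      (trans (*-assoc _ _ _) (*-congˡ (*-congˡ (det-cong (λ x _ → Q≈N _ _ (punchInᵢ≢i k x))))))))

  det-equalRows₀ : ∀ {n} (M : Mat (suc n)) j → (∀ c → M zero c ≈ M (suc j) c) → det M ≈ 0#
  det-equalRows₀ {suc n} M zero M₀≈M₁ =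
    trans (altSum-cong (λ j → sym (altSum-*ˡ (M zero j) (λ l → M (suc zero) (punchIn j l) * det (minor zero l (minor zero j M))))))
          (altSum²-symmetric (suc n) F F-symmetric)
    where
    F : Fin (suc (suc n)) → Fin (suc n) → Carrier
    F j l = M zero j * (M (suc zero) (punchIn j l) * det (minor zero l (minor zero j M)))
    F-symmetric : ∀ j l → F j l ≈ F (punchIn j l) (swapIndex j l)
    F-symmetric j l =
      trans (*-congˡ (*-cong (sym (M₀≈M₁ _)) (det-cong (λ a b → reflexive (≡.cong (M (suc (suc a))) (punchIn-punchIn j l b))))))
      (trans (x∙yz≈y∙xz _ _ _)
      (*-congˡ (*-congʳ (trans (reflexive (≡.cong (M zero) (≡.sym (punchIn-swapIndex j l)))) (M₀≈M₁ _)))))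
  det-equalRows₀ {suc (suc n)} M (suc j) M₀≈M₁ =
    trans (det-expandRow M (suc zero))
          (trans (*-congˡ (altSum-zero {f = λ c → M (suc zero) c * det (minor (suc zero) c M)}
                    (λ c → trans (*-congˡ (det-equalRows₀ (minor (suc zero) c M) j (λ c' → M₀≈M₁ (punchIn c c')))) (zeroʳ _))))
                 (zeroʳ _))

  det-equalRows : ∀ {n} (M : Mat (suc n)) i j → (∀ c → M i c ≈ M (punchIn i j) c) → det M ≈ 0#
  det-equalRows M zero j eq = det-equalRows₀ M j eq
  det-equalRows {suc n} M (suc i) zero eq = det-equalRows₀ M i (λ c → sym (eq c))
  det-equalRows {suc n} M (suc i) (suc j) eq =
    altSum-zero {f = λ c → M zero c * det (minor zero c M)}
      (λ c → trans (*-congˡ (det-equalRows (minor zero c M) i j (λ c' → eq (punchIn c c')))) (zeroʳ _))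

  setRow : ∀ {n} → Fin n → (Fin n → Carrier) → Mat n → Mat n
  setRow k r M i j with i ≟ᶠ k
  ... | yes _ = r j
  ... | no _  = M i j

  setRow-here : ∀ {n} (k : Fin n) r M j → setRow k r M k j ≈ r j
  setRow-here k r M j with k ≟ᶠ k
  ... | yes _  = refl
  ... | no k≢k = ⊥-elim (k≢k ≡.refl)

  setRow-other : ∀ {n} (k : Fin n) r M i j → i ≢ k → setRow k r M i j ≈ M i j
  setRow-other k r M i j i≢k with i ≟ᶠ k
  ... | yes i≡k = ⊥-elim (i≢k i≡k)
  ... | no _    = refl

  addRow : ∀ {n} → Fin n → Fin n → Carrier → Mat n → Mat n
  addRow k l a M = setRow k (λ j → M k j + a * M l j) M

  addCol : ∀ {n} → Fin n → Fin n → Carrier → Mat n → Mat n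
  addCol k l a M = addRow k l a (M ᵀ) ᵀ

  -- By linearity in row k, the change in the determinant is a times the
  -- determinant of a matrix with two equal rows.
  det-addRow : ∀ {n} k (l : Fin n) a (M : Mat (suc n)) → det (addRow k (punchIn k l) a M) ≈ det M
  det-addRow k l a M = begin
    det (addRow k l′ a M)     ≈⟨ det-linearRow M N (addRow k l′ a M) k 1# a (setRow-other k _ M) Q≈N Qₖ ⟩
    1# * det M + a * det N    ≈⟨ +-cong (*-identityˡ _) (trans (*-congˡ N-singular) (zeroʳ a)) ⟩
    det M + 0#                ≈⟨ +-identityʳ _ ⟩
    det M                     ∎
    where
    l′ = punchIn k l
    N = setRow k (M l′) M
    Q≈N : ∀ i j → i ≢ k → addRow k l′ a M i j ≈ N i j
    Q≈N i j i≢k = trans (setRow-other k _ M i j i≢k) (sym (setRow-other k _ M i j i≢k))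
    Qₖ : ∀ j → addRow k l′ a M k j ≈ 1# * M k j + a * N k j
    Qₖ j = trans (setRow-here k _ M j) (+-cong (sym (*-identityˡ _)) (*-congˡ (sym (setRow-here k _ M j))))
    N-singular : det N ≈ 0#
    N-singular = det-equalRows N k l
      (λ c → trans (setRow-here k _ M c) (sym (setRow-other k _ M _ c (punchInᵢ≢i k l))))

  det-addCol : ∀ {n} k (l : Fin n) a (M : Mat (suc n)) → det (addCol k (punchIn k l) a M) ≈ det M
  det-addCol k l a M = trans (det-ᵀ (addRow k (punchIn k l) a (M ᵀ))) (trans (det-addRow k l a (M ᵀ)) (det-ᵀ M))

  det-singleEntryCol : ∀ {n} (M : Mat (suc n)) r c → (∀ i → i ≢ r → M i c ≈ 0#) →
                       det M ≈ sign (toℕ c) * (sign (toℕ r) * (M r c * det (minor r c M)))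
  det-singleEntryCol M r c zeros = begin
    det M                                                          ≈⟨ det-ᵀ M ⟨
    det (M ᵀ)                                                      ≈⟨ det-expandRow (M ᵀ) c ⟩
    sign (toℕ c) * altSum (λ i → M i c * det (minor c i (M ᵀ)))
      ≈⟨ *-congˡ (altSum-single (λ i → M i c * det (minor c i (M ᵀ))) r (λ i i≢r → trans (*-congʳ (zeros i i≢r)) (zeroˡ _))) ⟩
    sign (toℕ c) * (sign (toℕ r) * (M r c * det (minor c r (M ᵀ)))) ≈⟨ *-congˡ (*-congˡ (*-congˡ (det-ᵀ (minor r c M)))) ⟩
    sign (toℕ c) * (sign (toℕ r) * (M r c * det (minor r c M)))    ∎

  -- Matrices given by a function on ℕ × ℕ, so that row permutations can be
  -- written as functions ℕ → ℕ without carrying range proofs.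
  toMat : ∀ n → (ℕ → ℕ → Carrier) → Mat n
  toMat n f i j = f (toℕ i) (toℕ j)

  RowSign : ℕ → (ℕ → ℕ) → Carrier → Set (c ⊔ ℓ)
  RowSign n p ε = ∀ f → det (toMat n (λ u v → f (p u) v)) ≈ ε * det (toMat n f)

  rowSign-id : ∀ n → RowSign n (λ u → u) 1#
  rowSign-id n f = sym (*-identityˡ _)

  rowSign-∘ : ∀ n p q ε δ → RowSign n p ε → RowSign n q δ → RowSign n (λ u → p (q u)) (δ * ε)
  rowSign-∘ n p q ε δ hp hq f = trans (hq (λ u v → f (p u) v)) (trans (*-congˡ (hp f)) (sym (*-assoc _ _ _)))

  rowSign-lift : ∀ n p ε → RowSign n p ε → RowSign (suc n) (liftℕ p) ε
  rowSign-lift n p ε hp f =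
    trans (altSum-cong {f = λ j → f 0 (toℕ j) * det (λ a b → f (suc (p (toℕ a))) (toℕ (punchIn j b)))}
                       (λ j → *-congˡ (minor-rows j)))
          (trans (altSum-cong (λ j → x∙yz≈y∙xz (f 0 (toℕ j)) ε (det (minor zero j (toMat (suc n) f)))))
                 (altSum-*ˡ ε (λ j → f 0 (toℕ j) * det (minor zero j (toMat (suc n) f)))))
    where
    minor-rows : ∀ j → det {n} (λ a b → f (suc (p (toℕ a))) (toℕ (punchIn j b))) ≈ ε * det (minor zero j (toMat (suc n) f))
    minor-rows j = begin
      det {n} (λ a b → f (suc (p (toℕ a))) (toℕ (punchIn j b)))
        ≈⟨ det-cong (λ a b → reflexive (≡.cong (f (suc (p (toℕ a)))) (toℕ-punchIn j b))) ⟩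
      det {n} (λ a b → f (suc (p (toℕ a))) (punchInℕ (toℕ j) (toℕ b)))
        ≈⟨ hp (λ u v → f (suc u) (punchInℕ (toℕ j) v)) ⟩
      ε * det {n} (λ a b → f (suc (toℕ a)) (punchInℕ (toℕ j) (toℕ b)))
        ≈⟨ *-congˡ (det-cong (λ a b → reflexive (≡.cong (f (suc (toℕ a))) (≡.sym (toℕ-punchIn j b))))) ⟩
      ε * det (minor zero j (toMat (suc n) f)) ∎

  -- Moving row k to the top: expanding along the new first row is expanding
  -- the old matrix along row k.
  rowSign-cycle : ∀ n (k : Fin (suc n)) → RowSign (suc n) (cycleℕ (toℕ k)) (sign (toℕ k))
  rowSign-cycle n k f = begin
    det (toMat (suc n) (λ u v → f (cycleℕ (toℕ k) u) v))  ≈⟨ det-cong cycled ⟩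
    det (λ i j → M (cycle i) j)                            ≡⟨⟩
    S                                                      ≈⟨ *-identityˡ S ⟨
    1# * S                                                 ≈⟨ *-congʳ (sign-involutive (toℕ k)) ⟨
    (ε * ε) * S                                            ≈⟨ *-assoc _ _ _ ⟩
    ε * (ε * S)                                            ≈⟨ *-congˡ (det-expandRow M k) ⟨
    ε * det M                                              ∎
    where
    M = toMat (suc n) f
    ε = sign (toℕ k)
    S = altSum (λ j → M k j * det (minor k j M))
    cycle : Fin (suc n) → Fin (suc n)
    cycle zero    = k
    cycle (suc a) = punchIn k a
    cycled : ∀ i j → f (cycleℕ (toℕ k) (toℕ i)) (toℕ j) ≈ M (cycle i) j
    cycled zero    j = refl
    cycled (suc a) j = reflexive (≡.cong (λ z → f z (toℕ j)) (≡.sym (toℕ-punchIn k a)))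

  det-conjugate : ∀ n p ε → RowSign n p ε → ε * ε ≈ 1# → ∀ f →
                  det (toMat n (λ u v → f (p u) (p v))) ≈ det (toMat n f)
  det-conjugate n p ε hp ε²≈1 f = begin
    det (toMat n (λ u v → f (p u) (p v)))        ≈⟨ hp (λ u v → f u (p v)) ⟩
    ε * det (toMat n (λ u v → f u (p v)))        ≈⟨ *-congˡ (det-ᵀ (toMat n (λ u v → f u (p v)))) ⟨
    ε * det (toMat n (λ u v → f v (p u)))        ≈⟨ *-congˡ (hp (λ u v → f v u)) ⟩
    ε * (ε * det (toMat n (λ u v → f v u)))      ≈⟨ *-congˡ (*-congˡ (det-ᵀ (toMat n f))) ⟩
    ε * (ε * det (toMat n f))                    ≈⟨ *-assoc _ _ _ ⟨
    (ε * ε) * det (toMat n f)                    ≈⟨ trans (*-congʳ ε²≈1) (*-identityˡ _) ⟩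
    det (toMat n f)                              ∎

  -- In det₂ and det₃ the left-hand polynomial is det unfolded along its definition.
  det₂ : (M : Mat 2) → det M ≈ M 0F 0F * M 1F 1F - M 0F 1F * M 1F 0F
  det₂ M = solve 4 (λ a b c d → a :* (d :* I :- O) :- (b :* (c :* I :- O) :- O) := a :* d :- b :* c) refl
             (M 0F 0F) (M 0F 1F) (M 1F 0F) (M 1F 1F)
    where
    O I : Polynomial 4
    O = con (+ 0)
    I = con (+ 1)

  det₃ : (M : Mat 3) →
    det M ≈ M 0F 0F * (M 1F 1F * M 2F 2F - M 1F 2F * M 2F 1F)
          - M 0F 1F * (M 1F 0F * M 2F 2F - M 1F 2F * M 2F 0F)
          + M 0F 2F * (M 1F 0F * M 2F 1F - M 1F 1F * M 2F 0F)
  det₃ M = solve 9 (λ a b c d e f g h i →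
      a :* (e :* (i :* I :- O) :- (f :* (h :* I :- O) :- O))
      :- (b :* (d :* (i :* I :- O) :- (f :* (g :* I :- O) :- O))
      :- (c :* (d :* (h :* I :- O) :- (e :* (g :* I :- O) :- O)) :- O))
      := a :* (e :* i :- f :* h) :- b :* (d :* i :- f :* g) :+ c :* (d :* h :- e :* g)) refl
    (M 0F 0F) (M 0F 1F) (M 0F 2F) (M 1F 0F) (M 1F 1F) (M 1F 2F) (M 2F 0F) (M 2F 1F) (M 2F 2F)
    where
    O I : Polynomial 9
    O = con (+ 0)
    I = con (+ 1)

data Kind : Set where
  clique pendant : Kind

kindDistℕ : Kind → Kind → ℕ
kindDistℕ clique  clique  = 1
kindDistℕ clique  pendant = 2
kindDistℕ pendant clique  = 2
kindDistℕ pendant pendant = 3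

-- pair k stands for k + 1 anchor–pendant pairs and occupies two indices
-- (anchor, pendant); lone m stands for m + 1 clique vertices without a
-- pendant and occupies one index.
data Block : Set where
  pair lone : ℕ → Block

kindAt : List Block → ℕ → Kind
kindAt []             u             = clique
kindAt (pair k ∷ bs)  0             = clique
kindAt (pair k ∷ bs)  1             = pendant
kindAt (pair k ∷ bs)  (suc (suc u)) = kindAt bs u
kindAt (lone m ∷ bs)  0             = clique
kindAt (lone m ∷ bs)  (suc u)       = kindAt bs u

classSize : List Block → ℕ → ℕ
classSize []            u             = 1
classSize (pair k ∷ bs) 0             = suc k
classSize (pair k ∷ bs) 1             = suc k
classSize (pair k ∷ bs) (suc (suc u)) = classSize bs u
classSize (lone m ∷ bs) 0             = suc m
classSize (lone m ∷ bs) (suc u)       = classSize bs u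

pairs : ℕ → List Block
pairs j = replicate j (pair 0)

lones : ℕ → List Block
lones l = replicate l (lone 0)

module Distances where
  open import Data.Bool.Base using (Bool; true; false; _∧_; _∨_; T; if_then_else_)
  open import Data.Nat.Base as ℕ using (ℕ; zero; suc; _<ᵇ_; _≤ᵇ_; _≡ᵇ_; _∸_; _+_; _≤_; _<_; z≤n; s≤s)
  import Data.Nat.Properties as ℕ
  open import Data.Fin.Base using (Fin; toℕ)
  open import Data.Fin.Properties using (_≟_)
  open import Data.List.Base using (List; []; _∷_; allFin)
  open import Data.Bool.ListAction using (any)
  open import Data.List.Membership.Propositional using (_∈_)
  open import Data.List.Membership.Propositional.Properties using (∈-allFin)
  open import Data.List.Relation.Unary.Any using (here; there)
  open import Data.Product.Base using (_×_; _,_; ∃)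
  open import Data.Sum.Base using (_⊎_; inj₁; inj₂)
  open import Data.Empty using (⊥-elim)
  open import Relation.Nullary using (¬_; yes; no)
  open import Relation.Binary.PropositionalEquality
  open import Function.Base using (_∘_)

  module BooleanTests where

    ∨-introʳ : ∀ a {b} → b ≡ true → a ∨ b ≡ true
    ∨-introʳ true  _ = refl
    ∨-introʳ false e = e

    ∨-elim : ∀ a b → a ∨ b ≡ true → a ≡ true ⊎ b ≡ true
    ∨-elim true  b e = inj₁ refl
    ∨-elim false b e = inj₂ e

    ∧-elim : ∀ a b → a ∧ b ≡ true → a ≡ true × b ≡ true
    ∧-elim true true e = refl , refl

    any-false : ∀ {A : Set} (f : A → Bool) xs → (∀ x → f x ≡ false) → any f xs ≡ false
    any-false f []       h = refl
    any-false f (x ∷ xs) h rewrite h x = any-false f xs h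

    any-true : ∀ {A : Set} (f : A → Bool) {xs} x → x ∈ xs → f x ≡ true → any f xs ≡ true
    any-true f x (here refl) e rewrite e = refl
    any-true f {y ∷ _} x (there x∈xs) e = ∨-introʳ (f y) (any-true f x x∈xs e)

    any-witness : ∀ {A : Set} (f : A → Bool) xs → any f xs ≡ true → ∃ λ x → f x ≡ true
    any-witness f (y ∷ xs) e with f y in eq
    ... | true  = y , eq
    ... | false = any-witness f xs e

    T⇒≡true : ∀ {b} → T b → b ≡ true
    T⇒≡true {true} _ = refl

    ¬T⇒≡false : ∀ {b} → ¬ T b → b ≡ false
    ¬T⇒≡false {true}  ¬t = ⊥-elim (¬t _)
    ¬T⇒≡false {false} _  = refl

    <ᵇ-true : ∀ {a b} → a < b → (a <ᵇ b) ≡ true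
    <ᵇ-true a<b = T⇒≡true (ℕ.<⇒<ᵇ a<b)

    <ᵇ-false : ∀ {a b} → b ≤ a → (a <ᵇ b) ≡ false
    <ᵇ-false {a} {b} b≤a = ¬T⇒≡false (λ t → ℕ.<⇒≱ (ℕ.<ᵇ⇒< a b t) b≤a)

    ≤ᵇ-true : ∀ {a b} → a ≤ b → (a ≤ᵇ b) ≡ true
    ≤ᵇ-true a≤b = T⇒≡true (ℕ.≤⇒≤ᵇ a≤b)

    ≤ᵇ-false : ∀ {a b} → b < a → (a ≤ᵇ b) ≡ false
    ≤ᵇ-false {a} {b} b<a = ¬T⇒≡false (λ t → ℕ.<⇒≱ b<a (ℕ.≤ᵇ⇒≤ a b t))

    ≡ᵇ-true : ∀ {a b} → a ≡ b → (a ≡ᵇ b) ≡ true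
    ≡ᵇ-true {a} {b} a≡b = T⇒≡true (ℕ.≡⇒≡ᵇ a b a≡b)

    ≡ᵇ-false : ∀ {a b} → a ≢ b → (a ≡ᵇ b) ≡ false
    ≡ᵇ-false {a} {b} a≢b = ¬T⇒≡false (λ t → a≢b (ℕ.≡ᵇ⇒≡ a b t))

    ≡ᵇ-sound : ∀ {a b} → (a ≡ᵇ b) ≡ true → a ≡ b
    ≡ᵇ-sound {a} {b} e = ℕ.≡ᵇ⇒≡ a b (subst T (sym e) _)

    ≤ᵇ-sound : ∀ {a b} → (a ≤ᵇ b) ≡ true → a ≤ b
    ≤ᵇ-sound {a} {b} e = ℕ.≤ᵇ⇒≤ a b (subst T (sym e) _)

  open BooleanTests

  module ShortestPaths {n} (adj : Adj n) where

    reach-refl : ∀ k i → reach adj k i i ≡ true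
    reach-refl zero    i with i ≟ i
    ... | yes _   = refl
    ... | no i≢i  = ⊥-elim (i≢i refl)
    reach-refl (suc k) i rewrite reach-refl k i = refl

    reach-step : ∀ k i m j → reach adj k i m ≡ true → adj m j ≡ true → reach adj (suc k) i j ≡ true
    reach-step k i m j i⇝m m~j =
      ∨-introʳ (reach adj k i j) (any-true _ m (∈-allFin m) (cong₂ _∧_ i⇝m m~j))

    reach₀-sound : ∀ {i j} → reach adj 0 i j ≡ true → i ≡ j
    reach₀-sound {i} {j} e with i ≟ j
    ... | yes i≡j = i≡j

    reach₀-false : ∀ {i j} → i ≢ j → reach adj 0 i j ≡ false
    reach₀-false {i} {j} i≢j with i ≟ j
    ... | yes i≡j = ⊥-elim (i≢j i≡j)
    ... | no _    = refl

    reach₁-sound : ∀ {i j} → reach adj 1 i j ≡ true → i ≡ j ⊎ adj i j ≡ true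
    reach₁-sound {i} {j} e with ∨-elim (reach adj 0 i j) _ e
    ... | inj₁ i⇝j = inj₁ (reach₀-sound i⇝j)
    ... | inj₂ via with any-witness _ (allFin n) via
    ...   | m , e′ with ∧-elim (reach adj 0 i m) (adj m j) e′
    ...     | i⇝m , m~j with reach₀-sound i⇝m
    ...       | refl = inj₂ m~j

    reach-suc-false : ∀ k {i j} → reach adj k i j ≡ false →
                      (∀ m → reach adj k i m ≡ true → adj m j ≡ false) → reach adj (suc k) i j ≡ false
    reach-suc-false k {i} {j} e h rewrite e = any-false _ (allFin n) last-step
      where
      last-step : ∀ m → (reach adj k i m ∧ adj m j) ≡ false
      last-step m with reach adj k i m in i⇝m
      ... | true  = h m i⇝m
      ... | false = refl

    distAux-exact : ∀ i j f k e → e < f → reach adj (k + e) i j ≡ true →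
                    (∀ z → k ≤ z → z < k + e → reach adj z i j ≡ false) → distAux adj i j f k ≡ k + e
    distAux-exact i j (suc f) k zero    _         hit _ rewrite ℕ.+-identityʳ k | hit = refl
    distAux-exact i j (suc f) k (suc e) (s≤s e<f) hit miss with reach adj k i j in eq
    ... | true  = ⊥-elim (true≢false (trans (sym eq) (miss k ℕ.≤-refl (ℕ.m<m+n k (s≤s z≤n)))))
      where
      true≢false : true ≢ false
      true≢false ()
    ... | false = trans
      (distAux-exact i j f (suc k) e e<f (subst (λ z → reach adj z i j ≡ true) (ℕ.+-suc k e) hit)
         (λ z k<z z<k+e → miss z (ℕ.≤-trans (ℕ.n≤1+n k) k<z) (subst (z <_) (sym (ℕ.+-suc k e)) z<k+e)))
      (sym (ℕ.+-suc k e))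

    dist-exact : ∀ i j d → d < n → reach adj d i j ≡ true → (∀ k → k < d → reach adj k i j ≡ false) →
                 dist adj i j ≡ d
    dist-exact i j d d<n hit miss = distAux-exact i j n 0 d d<n hit (λ z _ z<d → miss z z<d)

    dist≡0 : ∀ {i j} → 0 < n → i ≡ j → dist adj i j ≡ 0
    dist≡0 {i} 0<n refl = dist-exact i i 0 0<n (reach-refl 0 i) (λ _ ())

    dist≡1 : ∀ {i j} → 1 < n → i ≢ j → adj i j ≡ true → dist adj i j ≡ 1
    dist≡1 {i} {j} 1<n i≢j i~j = dist-exact i j 1 1<n (reach-step 0 i i j (reach-refl 0 i) i~j)
      λ { zero _ → reach₀-false i≢j ; (suc _) (s≤s ()) }

    reach₁-false : ∀ {i j} → i ≢ j → adj i j ≡ false → reach adj 1 i j ≡ false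
    reach₁-false {i} {j} i≢j i≁j = reach-suc-false 0 (reach₀-false i≢j)
      (λ m i⇝m → subst (λ z → adj z j ≡ false) (reach₀-sound i⇝m) i≁j)

    dist≡2 : ∀ {i j} m → 2 < n → i ≢ j → adj i j ≡ false → adj i m ≡ true → adj m j ≡ true →
             dist adj i j ≡ 2
    dist≡2 {i} {j} m 2<n i≢j i≁j i~m m~j =
      dist-exact i j 2 2<n (reach-step 1 i m j (reach-step 0 i i m (reach-refl 0 i) i~m) m~j)
        λ { zero _ → reach₀-false i≢j ; (suc zero) _ → reach₁-false i≢j i≁j ; (suc (suc _)) (s≤s (s≤s ())) }

    dist≡3 : ∀ {i j} m₁ m₂ → 3 < n → i ≢ j → adj i j ≡ false →
             (∀ m → adj i m ≡ true → adj m j ≡ false) →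
             adj i m₁ ≡ true → adj m₁ m₂ ≡ true → adj m₂ j ≡ true → dist adj i j ≡ 3
    dist≡3 {i} {j} m₁ m₂ 3<n i≢j i≁j no-common i~m₁ m₁~m₂ m₂~j =
      dist-exact i j 3 3<n
        (reach-step 2 i m₂ j (reach-step 1 i m₁ m₂ (reach-step 0 i i m₁ (reach-refl 0 i) i~m₁) m₁~m₂) m₂~j)
        λ { zero _ → reach₀-false i≢j
          ; (suc zero) _ → reach₁-false i≢j i≁j
          ; (suc (suc zero)) _ → reach-suc-false 1 (reach₁-false i≢j i≁j) not-via
          ; (suc (suc (suc _))) (s≤s (s≤s (s≤s ()))) }
      where
      not-via : ∀ m → reach adj 1 i m ≡ true → adj m j ≡ false
      not-via m i⇝m with reach₁-sound i⇝m
      ... | inj₁ refl = i≁j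
      ... | inj₂ i~m  = no-common m i~m

  kDist : ℕ → ℕ → ℕ → ℕ
  kDist s a b =
    if a ≡ᵇ b then 0
    else if a <ᵇ s then (if b <ᵇ s then 1 else if b ∸ s ≡ᵇ a then 1 else 2)
    else if b <ᵇ s then (if a ∸ s ≡ᵇ b then 1 else 2)
    else 3

  module KDist where

    kDist-refl : ∀ s a → kDist s a a ≡ 0
    kDist-refl s a rewrite ≡ᵇ-true {a} refl = refl

    kDist-clique : ∀ {s a b} → a < s → b < s → a ≢ b → kDist s a b ≡ 1
    kDist-clique a<s b<s a≢b rewrite ≡ᵇ-false a≢b | <ᵇ-true a<s | <ᵇ-true b<s = refl

    kDist-clique-ownPendant : ∀ {s a b} → a < s → s ≤ b → b ∸ s ≡ a → kDist s a b ≡ 1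
    kDist-clique-ownPendant {s} a<s s≤b e
      rewrite ≡ᵇ-false (λ a≡b → ℕ.<⇒≱ a<s (subst (s ≤_) (sym a≡b) s≤b)) | <ᵇ-true a<s | <ᵇ-false s≤b | ≡ᵇ-true e = refl

    kDist-clique-pendant : ∀ {s a b} → a < s → s ≤ b → b ∸ s ≢ a → kDist s a b ≡ 2
    kDist-clique-pendant {s} a<s s≤b ne
      rewrite ≡ᵇ-false (λ a≡b → ℕ.<⇒≱ a<s (subst (s ≤_) (sym a≡b) s≤b)) | <ᵇ-true a<s | <ᵇ-false s≤b | ≡ᵇ-false ne = refl

    kDist-ownPendant-clique : ∀ {s a b} → s ≤ a → b < s → a ∸ s ≡ b → kDist s a b ≡ 1
    kDist-ownPendant-clique {s} s≤a b<s e
      rewrite ≡ᵇ-false (λ a≡b → ℕ.<⇒≱ b<s (subst (s ≤_) a≡b s≤a)) | <ᵇ-false s≤a | <ᵇ-true b<s | ≡ᵇ-true e = refl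

    kDist-pendant-clique : ∀ {s a b} → s ≤ a → b < s → a ∸ s ≢ b → kDist s a b ≡ 2
    kDist-pendant-clique {s} s≤a b<s ne
      rewrite ≡ᵇ-false (λ a≡b → ℕ.<⇒≱ b<s (subst (s ≤_) a≡b s≤a)) | <ᵇ-false s≤a | <ᵇ-true b<s | ≡ᵇ-false ne = refl

    kDist-pendants : ∀ {s a b} → s ≤ a → s ≤ b → a ≢ b → kDist s a b ≡ 3
    kDist-pendants s≤a s≤b a≢b rewrite ≡ᵇ-false a≢b | <ᵇ-false s≤a | <ᵇ-false s≤b = refl

  open KDist

  module PendantGraph (s t : ℕ) (t≤s : t ≤ s) where
    open import Data.Fin.Base using (fromℕ<)
    open import Data.Fin.Properties using (toℕ<n; toℕ-fromℕ<; toℕ-injective)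

    A : Adj (s + t)
    A = KAdj s t

    anchor< : ∀ {a} → a < s + t → s ≤ a → a ∸ s < s
    anchor< {a} a<n s≤a = ℕ.≤-trans (subst (a ∸ s <_) (ℕ.m+n∸m≡n s t) (ℕ.∸-monoˡ-< a<n s≤a)) t≤s

    adj-clique : ∀ i j → toℕ i < s → toℕ j < s → toℕ i ≢ toℕ j → A i j ≡ true
    adj-clique i j i<s j<s ne rewrite <ᵇ-true i<s | <ᵇ-true j<s | ≡ᵇ-false ne = refl

    adj-anchor-pendant : ∀ i j → toℕ i < s → s ≤ toℕ j → toℕ j ∸ s ≡ toℕ i → A i j ≡ true
    adj-anchor-pendant i j i<s s≤j e
      rewrite <ᵇ-true i<s | <ᵇ-false s≤j | ≤ᵇ-false i<s | ≤ᵇ-true s≤j | ≡ᵇ-true (sym e) = refl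

    adj-pendant-anchor : ∀ i j → s ≤ toℕ i → toℕ j < s → toℕ i ∸ s ≡ toℕ j → A i j ≡ true
    adj-pendant-anchor i j s≤i j<s e rewrite <ᵇ-false s≤i | ≤ᵇ-true s≤i | ≡ᵇ-true (sym e) = refl

    nonadj-clique-pendant : ∀ i j → toℕ i < s → s ≤ toℕ j → toℕ j ∸ s ≢ toℕ i → A i j ≡ false
    nonadj-clique-pendant i j i<s s≤j ne
      rewrite <ᵇ-true i<s | <ᵇ-false s≤j | ≤ᵇ-false i<s | ≤ᵇ-true s≤j | ≡ᵇ-false (ne ∘ sym) = refl

    nonadj-pendant-clique : ∀ i j → s ≤ toℕ i → toℕ j < s → toℕ i ∸ s ≢ toℕ j → A i j ≡ false
    nonadj-pendant-clique i j s≤i j<s ne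
      rewrite <ᵇ-false s≤i | ≤ᵇ-true s≤i | ≡ᵇ-false (ne ∘ sym) | ≤ᵇ-false j<s = refl

    nonadj-pendants : ∀ i j → s ≤ toℕ i → s ≤ toℕ j → A i j ≡ false
    nonadj-pendants i j s≤i s≤j
      rewrite <ᵇ-false s≤i | ≤ᵇ-true s≤i | ≤ᵇ-true s≤j
            | ≡ᵇ-false {toℕ j} {toℕ i ∸ s} (λ e → ℕ.<⇒≱ (anchor< (toℕ<n i) s≤i) (subst (s ≤_) e s≤j))
            | ≡ᵇ-false {toℕ i} {toℕ j ∸ s} (λ e → ℕ.<⇒≱ (anchor< (toℕ<n j) s≤j) (subst (s ≤_) e s≤i)) = refl

    pendant-neighbour : ∀ i m → s ≤ toℕ i → A i m ≡ true → toℕ m ≡ toℕ i ∸ s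
    pendant-neighbour i m s≤i e rewrite <ᵇ-false s≤i | ≤ᵇ-true s≤i with ∨-elim (toℕ m ≡ᵇ (toℕ i ∸ s)) _ e
    ... | inj₁ e₁ = ≡ᵇ-sound e₁
    ... | inj₂ e₂ with ∧-elim (s ≤ᵇ toℕ m) _ e₂
    ...   | s≤ᵇm , e₃ = ⊥-elim (ℕ.<⇒≱ (anchor< (toℕ<n m) (≤ᵇ-sound s≤ᵇm)) (subst (s ≤_) (≡ᵇ-sound e₃) s≤i))

    anchorOf : ∀ i → s ≤ toℕ i → Fin (s + t)
    anchorOf i s≤i = fromℕ< (ℕ.≤-trans (anchor< (toℕ<n i) s≤i) (ℕ.m≤m+n s t))

    toℕ-anchorOf : ∀ i s≤i → toℕ (anchorOf i s≤i) ≡ toℕ i ∸ s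
    toℕ-anchorOf i s≤i = toℕ-fromℕ< _

    anchorOf< : ∀ i s≤i → toℕ (anchorOf i s≤i) < s
    anchorOf< i s≤i = subst (_< s) (sym (toℕ-anchorOf i s≤i)) (anchor< (toℕ<n i) s≤i)

    module _ (2≤t : 2 ≤ t) where
      open ShortestPaths A

      3<n : 3 < s + t
      3<n = ℕ.+-mono-≤ (ℕ.≤-trans 2≤t t≤s) 2≤t

      2<n : 2 < s + t
      2<n = ℕ.<-trans (ℕ.n<1+n 2) 3<n

      1<n : 1 < s + t
      1<n = ℕ.<-trans (ℕ.n<1+n 1) 2<n

      DK≡kDist : ∀ i j → DK s t i j ≡ kDist s (toℕ i) (toℕ j)
      DK≡kDist i j with toℕ i ℕ.≟ toℕ j | toℕ i ℕ.<? s | toℕ j ℕ.<? s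
      ... | yes i≡j | _ | _ =
        trans (dist≡0 (ℕ.<-trans (s≤s z≤n) 3<n) (toℕ-injective i≡j))
              (sym (trans (cong (kDist s (toℕ i)) (sym i≡j)) (kDist-refl s (toℕ i))))
      ... | no i≢j | yes i<s | yes j<s =
        trans (dist≡1 1<n (i≢j ∘ cong toℕ) (adj-clique i j i<s j<s i≢j)) (sym (kDist-clique i<s j<s i≢j))
      ... | no i≢j | yes i<s | no j≮s with toℕ j ∸ s ℕ.≟ toℕ i
      ...   | yes e =
        trans (dist≡1 1<n (i≢j ∘ cong toℕ) (adj-anchor-pendant i j i<s s≤j e)) (sym (kDist-clique-ownPendant i<s s≤j e))
        where s≤j = ℕ.≮⇒≥ j≮s
      ...   | no ne =
        trans (dist≡2 m 2<n (i≢j ∘ cong toℕ) (nonadj-clique-pendant i j i<s s≤j ne)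
                      (adj-clique i m i<s (anchorOf< j s≤j) (λ e → ne (sym (trans e (toℕ-anchorOf j s≤j)))))
                      (adj-anchor-pendant m j (anchorOf< j s≤j) s≤j (sym (toℕ-anchorOf j s≤j))))
              (sym (kDist-clique-pendant i<s s≤j ne))
        where
        s≤j = ℕ.≮⇒≥ j≮s
        m = anchorOf j s≤j
      DK≡kDist i j | no i≢j | no i≮s | yes j<s with toℕ i ∸ s ℕ.≟ toℕ j
      ...   | yes e =
        trans (dist≡1 1<n (i≢j ∘ cong toℕ) (adj-pendant-anchor i j s≤i j<s e)) (sym (kDist-ownPendant-clique s≤i j<s e))
        where s≤i = ℕ.≮⇒≥ i≮s
      ...   | no ne =
        trans (dist≡2 m 2<n (i≢j ∘ cong toℕ) (nonadj-pendant-clique i j s≤i j<s ne)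
                      (adj-pendant-anchor i m s≤i (anchorOf< i s≤i) (sym (toℕ-anchorOf i s≤i)))
                      (adj-clique m j (anchorOf< i s≤i) j<s (λ e → ne (trans (sym (toℕ-anchorOf i s≤i)) e))))
              (sym (kDist-pendant-clique s≤i j<s ne))
        where
        s≤i = ℕ.≮⇒≥ i≮s
        m = anchorOf i s≤i
      DK≡kDist i j | no i≢j | no i≮s | no j≮s =
        trans (dist≡3 m₁ m₂ 3<n (i≢j ∘ cong toℕ) (nonadj-pendants i j s≤i s≤j) no-common
                      (adj-pendant-anchor i m₁ s≤i (anchorOf< i s≤i) (sym (toℕ-anchorOf i s≤i)))
                      (adj-clique m₁ m₂ (anchorOf< i s≤i) (anchorOf< j s≤j) anchors-differ)
                      (adj-anchor-pendant m₂ j (anchorOf< j s≤j) s≤j (sym (toℕ-anchorOf j s≤j))))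
              (sym (kDist-pendants s≤i s≤j i≢j))
        where
        s≤i = ℕ.≮⇒≥ i≮s
        s≤j = ℕ.≮⇒≥ j≮s
        m₁ = anchorOf i s≤i
        m₂ = anchorOf j s≤j
        anchors≢ : toℕ i ∸ s ≢ toℕ j ∸ s
        anchors≢ e = i≢j (trans (sym (ℕ.m∸n+n≡m s≤i)) (trans (cong (_+ s) e) (ℕ.m∸n+n≡m s≤j)))
        anchors-differ : toℕ m₁ ≢ toℕ m₂
        anchors-differ e = anchors≢ (trans (sym (toℕ-anchorOf i s≤i)) (trans e (toℕ-anchorOf j s≤j)))
        no-common : ∀ m → A i m ≡ true → A m j ≡ false
        no-common m i~m = nonadj-clique-pendant m j m<s s≤j (λ e → anchors≢ (trans (sym m≡) (sym e)))
          where
          m≡ = pendant-neighbour i m s≤i i~m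
          m<s = subst (_< s) (sym m≡) (anchor< (toℕ<n i) s≤i)

  -- K_s^t sits inside K_(s+1)^(t+1) as the vertices other than the new clique
  -- vertex 0 and its pendant s + 1.
  embed : ℕ → ℕ → ℕ
  embed s c = suc (punchInℕ s c)

  data Side (s c : ℕ) : Set where
    inClique  : c < s → Side s c
    isPendant : s ≤ c → Side s c

  side : ∀ s c → Side s c
  side s c with c ℕ.<? s
  ... | yes c<s = inClique c<s
  ... | no  c≮s = isPendant (ℕ.≮⇒≥ c≮s)

  embed-clique : ∀ {s c} → c < s → embed s c ≡ suc c
  embed-clique c<s rewrite <ᵇ-true c<s = refl

  embed-pendant : ∀ {s c} → s ≤ c → embed s c ≡ suc (suc c)
  embed-pendant s≤c rewrite <ᵇ-false s≤c = refl

  embed-injective : ∀ s c d → embed s c ≡ embed s d → c ≡ d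
  embed-injective s c d e with side s c | side s d
  ... | inClique c<s  | inClique d<s  = ℕ.suc-injective (trans (sym (embed-clique c<s)) (trans e (embed-clique d<s)))
  ... | inClique c<s  | isPendant s≤d =
    ⊥-elim (ℕ.<⇒≱ c<s (ℕ.≤-trans (ℕ.n≤1+n s) (subst (suc s ≤_) (sym (ℕ.suc-injective
      (trans (sym (embed-clique c<s)) (trans e (embed-pendant s≤d))))) (s≤s s≤d))))
  ... | isPendant s≤c | inClique d<s  =
    ⊥-elim (ℕ.<⇒≱ d<s (ℕ.≤-trans (ℕ.n≤1+n s) (subst (suc s ≤_) (sym (ℕ.suc-injective
      (trans (sym (embed-clique d<s)) (trans (sym e) (embed-pendant s≤c))))) (s≤s s≤c))))
  ... | isPendant s≤c | isPendant s≤d =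
    ℕ.suc-injective (ℕ.suc-injective (trans (sym (embed-pendant s≤c)) (trans e (embed-pendant s≤d))))

  pendant-shift : ∀ {s c} → s ≤ c → suc c ∸ s ≡ suc (c ∸ s)
  pendant-shift s≤c = ℕ.+-∸-assoc 1 s≤c

  kDist-embed : ∀ s c d → kDist (suc s) (embed s c) (embed s d) ≡ kDist s c d
  kDist-embed s c d with side s c | side s d | c ℕ.≟ d
  ... | _ | _ | yes refl = trans (kDist-refl (suc s) (embed s c)) (sym (kDist-refl s c))
  ... | inClique c<s | inClique d<s | no c≢d =
    trans (cong₂ (kDist (suc s)) (embed-clique c<s) (embed-clique d<s))
          (trans (kDist-clique (s≤s c<s) (s≤s d<s) (c≢d ∘ ℕ.suc-injective)) (sym (kDist-clique c<s d<s c≢d)))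
  ... | inClique c<s | isPendant s≤d | no _ with d ∸ s ℕ.≟ c
  ...   | yes e =
    trans (cong₂ (kDist (suc s)) (embed-clique c<s) (embed-pendant s≤d))
          (trans (kDist-clique-ownPendant (s≤s c<s) (s≤s (ℕ.m≤n⇒m≤1+n s≤d)) (trans (pendant-shift s≤d) (cong suc e)))
                 (sym (kDist-clique-ownPendant c<s s≤d e)))
  ...   | no ne =
    trans (cong₂ (kDist (suc s)) (embed-clique c<s) (embed-pendant s≤d))
          (trans (kDist-clique-pendant (s≤s c<s) (s≤s (ℕ.m≤n⇒m≤1+n s≤d)) (ne ∘ ℕ.suc-injective ∘ trans (sym (pendant-shift s≤d))))
                 (sym (kDist-clique-pendant c<s s≤d ne)))
  kDist-embed s c d | isPendant s≤c | inClique d<s | no _ with c ∸ s ℕ.≟ d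
  ...   | yes e =
    trans (cong₂ (kDist (suc s)) (embed-pendant s≤c) (embed-clique d<s))
          (trans (kDist-ownPendant-clique (s≤s (ℕ.m≤n⇒m≤1+n s≤c)) (s≤s d<s) (trans (pendant-shift s≤c) (cong suc e)))
                 (sym (kDist-ownPendant-clique s≤c d<s e)))
  ...   | no ne =
    trans (cong₂ (kDist (suc s)) (embed-pendant s≤c) (embed-clique d<s))
          (trans (kDist-pendant-clique (s≤s (ℕ.m≤n⇒m≤1+n s≤c)) (s≤s d<s) (ne ∘ ℕ.suc-injective ∘ trans (sym (pendant-shift s≤c))))
                 (sym (kDist-pendant-clique s≤c d<s ne)))
  kDist-embed s c d | isPendant s≤c | isPendant s≤d | no c≢d =
    trans (cong₂ (kDist (suc s)) (embed-pendant s≤c) (embed-pendant s≤d))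
          (trans (kDist-pendants (s≤s (ℕ.m≤n⇒m≤1+n s≤c)) (s≤s (ℕ.m≤n⇒m≤1+n s≤d)) (c≢d ∘ ℕ.suc-injective ∘ ℕ.suc-injective))
                 (sym (kDist-pendants s≤c s≤d c≢d)))

  kindOf : ℕ → ℕ → Kind
  kindOf s a = if a <ᵇ s then clique else pendant

  kindOf-clique : ∀ {s a} → a < s → kindOf s a ≡ clique
  kindOf-clique a<s rewrite <ᵇ-true a<s = refl

  kindOf-pendant : ∀ {s a} → s ≤ a → kindOf s a ≡ pendant
  kindOf-pendant s≤a rewrite <ᵇ-false s≤a = refl

  kindOf-embed : ∀ s c → kindOf (suc s) (embed s c) ≡ kindOf s c
  kindOf-embed s c with side s c
  ... | inClique c<s  =
    trans (cong (kindOf (suc s)) (embed-clique c<s)) (trans (kindOf-clique (s≤s c<s)) (sym (kindOf-clique c<s)))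
  ... | isPendant s≤c =
    trans (cong (kindOf (suc s)) (embed-pendant s≤c))
          (trans (kindOf-pendant (s≤s (ℕ.m≤n⇒m≤1+n s≤c))) (sym (kindOf-pendant s≤c)))

  -- In the names below, anchor is the new clique vertex 0 and pendant its pendant s + 1.
  kDist-anchor-embed : ∀ s c → kDist (suc s) 0 (embed s c) ≡ kindDistℕ clique (kindOf s c)
  kDist-anchor-embed s c with side s c
  ... | inClique c<s  =
    trans (cong (kDist (suc s) 0) (embed-clique c<s))
          (trans (kDist-clique (s≤s z≤n) (s≤s c<s) (λ ())) (cong (kindDistℕ clique) (sym (kindOf-clique c<s))))
  ... | isPendant s≤c =
    trans (cong (kDist (suc s) 0) (embed-pendant s≤c))
          (trans (kDist-clique-pendant (s≤s z≤n) (s≤s (ℕ.m≤n⇒m≤1+n s≤c)) (ℕ.1+n≢0 ∘ trans (sym (pendant-shift s≤c))))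
                 (cong (kindDistℕ clique) (sym (kindOf-pendant s≤c))))

  kDist-embed-anchor : ∀ s c → kDist (suc s) (embed s c) 0 ≡ kindDistℕ (kindOf s c) clique
  kDist-embed-anchor s c with side s c
  ... | inClique c<s  =
    trans (cong (λ z → kDist (suc s) z 0) (embed-clique c<s))
          (trans (kDist-clique (s≤s c<s) (s≤s z≤n) (λ ())) (cong (λ k → kindDistℕ k clique) (sym (kindOf-clique c<s))))
  ... | isPendant s≤c =
    trans (cong (λ z → kDist (suc s) z 0) (embed-pendant s≤c))
          (trans (kDist-pendant-clique (s≤s (ℕ.m≤n⇒m≤1+n s≤c)) (s≤s z≤n) (ℕ.1+n≢0 ∘ trans (sym (pendant-shift s≤c))))
                 (cong (λ k → kindDistℕ k clique) (sym (kindOf-pendant s≤c))))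

  kDist-pendant-embed : ∀ s c → kDist (suc s) (suc s) (embed s c) ≡ kindDistℕ pendant (kindOf s c)
  kDist-pendant-embed s c with side s c
  ... | inClique c<s  =
    trans (cong (kDist (suc s) (suc s)) (embed-clique c<s))
          (trans (kDist-pendant-clique ℕ.≤-refl (s≤s c<s) (ℕ.0≢1+n ∘ trans (sym (ℕ.n∸n≡0 s))))
                 (cong (kindDistℕ pendant) (sym (kindOf-clique c<s))))
  ... | isPendant s≤c =
    trans (cong (kDist (suc s) (suc s)) (embed-pendant s≤c))
          (trans (kDist-pendants ℕ.≤-refl (s≤s (ℕ.m≤n⇒m≤1+n s≤c)) (ℕ.<⇒≢ (s≤s s≤c) ∘ ℕ.suc-injective))
                 (cong (kindDistℕ pendant) (sym (kindOf-pendant s≤c))))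

  kDist-embed-pendant : ∀ s c → kDist (suc s) (embed s c) (suc s) ≡ kindDistℕ (kindOf s c) pendant
  kDist-embed-pendant s c with side s c
  ... | inClique c<s  =
    trans (cong (λ z → kDist (suc s) z (suc s)) (embed-clique c<s))
          (trans (kDist-clique-pendant (s≤s c<s) ℕ.≤-refl (ℕ.0≢1+n ∘ trans (sym (ℕ.n∸n≡0 s))))
                 (cong (λ k → kindDistℕ k pendant) (sym (kindOf-clique c<s))))
  ... | isPendant s≤c =
    trans (cong (λ z → kDist (suc s) z (suc s)) (embed-pendant s≤c))
          (trans (kDist-pendants (s≤s (ℕ.m≤n⇒m≤1+n s≤c)) ℕ.≤-refl (ℕ.<⇒≢ (s≤s s≤c) ∘ sym ∘ ℕ.suc-injective))
                 (cong (λ k → kindDistℕ k pendant) (sym (kindOf-pendant s≤c))))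

  kDist-anchor-pendant : ∀ s → kDist (suc s) 0 (suc s) ≡ 1
  kDist-anchor-pendant s = kDist-clique-ownPendant {suc s} {0} {suc s} (s≤s z≤n) ℕ.≤-refl (ℕ.n∸n≡0 s)

  kDist-pendant-anchor : ∀ s → kDist (suc s) (suc s) 0 ≡ 1
  kDist-pendant-anchor s = kDist-ownPendant-clique {suc s} {suc s} {0} ℕ.≤-refl (s≤s z≤n) (ℕ.n∸n≡0 s)

open Distances
open BooleanTests
open KDist

module BlockMatrices {c ℓ : Level} (R : CommutativeRing c ℓ) (x : CommutativeRing.Carrier R) where
  open import Data.Integer.Base using (+_)
  open import Data.Empty using (⊥-elim)
  open CommutativeRing R hiding (zero)
  open RingDefs R using (fromℕ; _^_; det)
  open IntegerCoefficients R
  open Determinants R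
  open import Relation.Binary.Reasoning.Setoid setoid

  two three : Carrier
  two   = 1# + 1#
  three = 1# + two

  kindDist : Kind → Kind → Carrier
  kindDist clique  clique  = 1#
  kindDist clique  pendant = two
  kindDist pendant clique  = two
  kindDist pendant pendant = three

  -- The transpose of the quotient matrix of x I − D for the partition of the
  -- vertices into the classes described by the blocks: entry (u, v) is
  -- δ_uv x minus the size of the class of u times the distance between the
  -- classes.
  blockMatrix : List Block → ℕ → ℕ → Carrier
  blockMatrix []            u             v             = 0#
  blockMatrix (pair k ∷ bs) 0             0             = x - fromℕ k
  blockMatrix (pair k ∷ bs) 0             1             = - (1# + fromℕ k * two)
  blockMatrix (pair k ∷ bs) 1             0             = - (1# + fromℕ k * two)
  blockMatrix (pair k ∷ bs) 1             1             = x - fromℕ k * three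
  blockMatrix (pair k ∷ bs) 0             (suc (suc v)) = - ((1# + fromℕ k) * kindDist clique (kindAt bs v))
  blockMatrix (pair k ∷ bs) 1             (suc (suc v)) = - ((1# + fromℕ k) * kindDist pendant (kindAt bs v))
  blockMatrix (pair k ∷ bs) (suc (suc u)) 0             = - (fromℕ (classSize bs u) * kindDist (kindAt bs u) clique)
  blockMatrix (pair k ∷ bs) (suc (suc u)) 1             = - (fromℕ (classSize bs u) * kindDist (kindAt bs u) pendant)
  blockMatrix (pair k ∷ bs) (suc (suc u)) (suc (suc v)) = blockMatrix bs u v
  blockMatrix (lone m ∷ bs) 0             0             = x - fromℕ m
  blockMatrix (lone m ∷ bs) 0             (suc v)       = - ((1# + fromℕ m) * kindDist clique (kindAt bs v))
  blockMatrix (lone m ∷ bs) (suc u)       0             = - (fromℕ (classSize bs u) * kindDist (kindAt bs u) clique)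
  blockMatrix (lone m ∷ bs) (suc u)       (suc v)       = blockMatrix bs u v

  pairFactor : Carrier
  pairFactor = x * x + fromℕ 4 * x + fromℕ 2

  E0 E1 T2 T3 m1 : ∀ {n} → Polynomial n
  E0 = con (+ 0)
  E1 = con (+ 1)
  T2 = E1 :+ E1
  T3 = E1 :+ T2
  m1 = :- E1

  fN : ∀ {n} → ℕ → Polynomial n
  fN zero    = E0
  fN (suc k) = E1 :+ fN k

  pattern s4 i = suc (suc (suc (suc i)))

  cancel : ∀ a → a + - 1# * a ≈ 0#
  cancel = solve 1 (λ a → a :+ m1 :* a := E0) refl

  -- Subtract the columns of the first pair from those of the second and add
  -- the rows of the second pair to those of the first; then column 2 minus
  -- (x + 1) times column 3 has the single entry −pairFactor, after which
  -- column 3 has the single entry 1, and what is left is the block matrix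
  -- with the two pairs merged.
  module PairElimination (n k : ℕ) (rest : List Block) where
    M₀ : Mat (suc (suc (suc (suc n))))
    M₀ = toMat _ (blockMatrix (pair k ∷ pair 0 ∷ rest))
    M₁ = addCol 2F 0F (- 1#) M₀
    M₂ = addCol 3F 1F (- 1#) M₁
    M₃ = addRow 0F 2F 1# M₂
    M₄ = addRow 1F 3F 1# M₃
    M₅ = addCol 2F 3F (- (x + 1#)) M₄
    N = minor 3F 2F M₅

    Merged : Mat (suc (suc n))
    Merged = toMat _ (blockMatrix (pair (suc k) ∷ rest))

    column₂ : ∀ i → i ≢ 3F → M₅ i 2F ≈ 0#
    column₂ 0F _ = solve 2 (λ y f →
        ((:- ((E1 :+ f) :* E1) :+ m1 :* (y :- f)) :+ E1 :* ((y :- E0) :+ m1 :* (:- ((E1 :+ E0) :* E1))))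
        :+ :- (y :+ E1) :* ((:- ((E1 :+ f) :* T2) :+ m1 :* (:- (E1 :+ f :* T2)))
                            :+ E1 :* ((:- (E1 :+ E0 :* T2)) :+ m1 :* (:- ((E1 :+ E0) :* T2))))
        := E0) refl x (fromℕ k)
    column₂ 1F _ = solve 2 (λ y f →
        ((:- ((E1 :+ f) :* T2) :+ m1 :* (:- (E1 :+ f :* T2))) :+ E1 :* ((:- (E1 :+ E0 :* T2)) :+ m1 :* (:- ((E1 :+ E0) :* T2))))
        :+ :- (y :+ E1) :* ((:- ((E1 :+ f) :* T3) :+ m1 :* (y :- f :* T3))
                            :+ E1 :* ((y :- E0 :* T3) :+ m1 :* (:- ((E1 :+ E0) :* T3))))
        := E0) refl x (fromℕ k)
    column₂ 2F _ = solve 1 (λ y →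
        ((y :- E0) :+ m1 :* (:- ((E1 :+ E0) :* E1)))
        :+ :- (y :+ E1) :* ((:- (E1 :+ E0 :* T2)) :+ m1 :* (:- ((E1 :+ E0) :* T2)))
        := E0) refl x
    column₂ 3F 3≢3 = ⊥-elim (3≢3 ≡.refl)
    column₂ (s4 i) _ = solve 3 (λ y a b →
        (a :+ m1 :* a) :+ :- (y :+ E1) :* (b :+ m1 :* b) := E0) refl x _ _

    pivot₂ : M₅ 3F 2F ≈ - pairFactor
    pivot₂ = solve 1 (λ y →
        ((:- (E1 :+ E0 :* T2)) :+ m1 :* (:- ((E1 :+ E0) :* T2)))
        :+ :- (y :+ E1) :* ((y :- E0 :* T3) :+ m1 :* (:- ((E1 :+ E0) :* T3)))
        := :- (y :* y :+ fN 4 :* y :+ fN 2)) refl x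

    column₃ : ∀ i → i ≢ 2F → N i 2F ≈ 0#
    column₃ 0F _ = solve 1 (λ f →
        (:- ((E1 :+ f) :* T2) :+ m1 :* (:- (E1 :+ f :* T2))) :+ E1 :* ((:- (E1 :+ E0 :* T2)) :+ m1 :* (:- ((E1 :+ E0) :* T2)))
        := E0) refl (fromℕ k)
    column₃ 1F _ = solve 2 (λ y f →
        (:- ((E1 :+ f) :* T3) :+ m1 :* (y :- f :* T3)) :+ E1 :* ((y :- E0 :* T3) :+ m1 :* (:- ((E1 :+ E0) :* T3)))
        := E0) refl x (fromℕ k)
    column₃ 2F 2≢2 = ⊥-elim (2≢2 ≡.refl)
    column₃ (suc (suc (suc i))) _ = cancel _

    pivot₃ : N 2F 2F ≈ 1#
    pivot₃ = solve 0 ((:- (E1 :+ E0 :* T2)) :+ m1 :* (:- ((E1 :+ E0) :* T2)) := E1) refl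

    merged : ∀ a b → minor 2F 2F N a b ≈ Merged a b
    merged 0F 0F = solve 2 (λ y f → (y :- f) :+ E1 :* (:- ((E1 :+ E0) :* E1)) := y :- (E1 :+ f)) refl x (fromℕ k)
    merged 0F 1F = solve 1 (λ f →
        :- (E1 :+ f :* T2) :+ E1 :* (:- ((E1 :+ E0) :* T2)) := :- (E1 :+ (E1 :+ f) :* T2)) refl (fromℕ k)
    merged 0F (suc (suc b)) = solve 2 (λ f d →
        :- ((E1 :+ f) :* d) :+ E1 :* (:- ((E1 :+ E0) :* d)) := :- ((E1 :+ (E1 :+ f)) :* d)) refl (fromℕ k) _
    merged 1F 0F = solve 1 (λ f →
        :- (E1 :+ f :* T2) :+ E1 :* (:- ((E1 :+ E0) :* T2)) := :- (E1 :+ (E1 :+ f) :* T2)) refl (fromℕ k)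
    merged 1F 1F = solve 2 (λ y f → (y :- f :* T3) :+ E1 :* (:- ((E1 :+ E0) :* T3)) := y :- (E1 :+ f) :* T3) refl x (fromℕ k)
    merged 1F (suc (suc b)) = solve 2 (λ f d →
        :- ((E1 :+ f) :* d) :+ E1 :* (:- ((E1 :+ E0) :* d)) := :- ((E1 :+ (E1 :+ f)) :* d)) refl (fromℕ k) _
    merged (suc (suc a)) 0F = refl
    merged (suc (suc a)) 1F = refl
    merged (suc (suc a)) (suc (suc b)) = refl

    det-pairElimination : det M₀ ≈ pairFactor * det Merged
    det-pairElimination = begin
      det M₀    ≈⟨ det-addCol 2F 0F _ M₀ ⟨
      det M₁    ≈⟨ det-addCol 3F 1F _ M₁ ⟨
      det M₂    ≈⟨ det-addRow 0F 1F _ M₂ ⟨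
      det M₃    ≈⟨ det-addRow 1F 2F _ M₃ ⟨
      det M₄    ≈⟨ det-addCol 2F 2F _ M₄ ⟨
      det M₅    ≈⟨ det-singleEntryCol M₅ 3F 2F column₂ ⟩
      sign 2 * (sign 3 * (M₅ 3F 2F * det N))
        ≈⟨ *-congˡ (*-congˡ (*-cong pivot₂ (det-singleEntryCol N 2F 2F column₃))) ⟩
      sign 2 * (sign 3 * (- pairFactor * (sign 2 * (sign 2 * (N 2F 2F * det (minor 2F 2F N))))))
        ≈⟨ *-congˡ (*-congˡ (*-congˡ (*-congˡ (*-congˡ (*-cong pivot₃ (det-cong merged)))))) ⟩
      sign 2 * (sign 3 * (- pairFactor * (sign 2 * (sign 2 * (1# * det Merged)))))
        ≈⟨ solve 2 (λ a b → (:- (:- E1)) :* ((:- (:- (:- E1))) :* (:- a :* ((:- (:- E1)) :* ((:- (:- E1)) :* (E1 :* b)))))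
                           := a :* b) refl pairFactor (det Merged) ⟩
      pairFactor * det Merged ∎

  -- Subtracting column 2 from column 3 and adding row 3 to row 2 merges the
  -- second lone vertex into the first and isolates the entry x + 1.
  module LoneElimination (n k m : ℕ) (rest : List Block) where
    M₀ : Mat (suc (suc (suc (suc n))))
    M₀ = toMat _ (blockMatrix (pair k ∷ lone m ∷ lone 0 ∷ rest))
    M₁ = addCol 3F 2F (- 1#) M₀
    M₂ = addRow 2F 3F 1# M₁

    Merged : Mat (suc (suc (suc n)))
    Merged = toMat _ (blockMatrix (pair k ∷ lone (suc m) ∷ rest))

    column₃ : ∀ i → i ≢ 3F → M₂ i 3F ≈ 0#
    column₃ 0F _ = cancel _
    column₃ 1F _ = cancel _
    column₃ 2F _ = solve 2 (λ y g →
        ((:- ((E1 :+ g) :* E1)) :+ m1 :* (y :- g)) :+ E1 :* ((y :- E0) :+ m1 :* (:- ((E1 :+ E0) :* E1)))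
        := E0) refl x (fromℕ m)
    column₃ 3F 3≢3 = ⊥-elim (3≢3 ≡.refl)
    column₃ (s4 i) _ = cancel _

    pivot : M₂ 3F 3F ≈ x + 1#
    pivot = solve 1 (λ y → (y :- E0) :+ m1 :* (:- ((E1 :+ E0) :* E1)) := y :+ E1) refl x

    merged : ∀ a b → minor 3F 3F M₂ a b ≈ Merged a b
    merged 0F 0F = refl
    merged 0F 1F = refl
    merged 0F 2F = refl
    merged 0F (suc (suc (suc b))) = refl
    merged 1F 0F = refl
    merged 1F 1F = refl
    merged 1F 2F = refl
    merged 1F (suc (suc (suc b))) = refl
    merged 2F 0F = solve 1 (λ g →
        :- ((E1 :+ g) :* E1) :+ E1 :* (:- ((E1 :+ E0) :* E1)) := :- ((E1 :+ (E1 :+ g)) :* E1)) refl (fromℕ m)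
    merged 2F 1F = solve 1 (λ g →
        :- ((E1 :+ g) :* T2) :+ E1 :* (:- ((E1 :+ E0) :* T2)) := :- ((E1 :+ (E1 :+ g)) :* T2)) refl (fromℕ m)
    merged 2F 2F = solve 2 (λ y g → (y :- g) :+ E1 :* (:- ((E1 :+ E0) :* E1)) := y :- (E1 :+ g)) refl x (fromℕ m)
    merged 2F (suc (suc (suc b))) = solve 2 (λ g d →
        :- ((E1 :+ g) :* d) :+ E1 :* (:- ((E1 :+ E0) :* d)) := :- ((E1 :+ (E1 :+ g)) :* d)) refl (fromℕ m) _
    merged (suc (suc (suc a))) 0F = refl
    merged (suc (suc (suc a))) 1F = refl
    merged (suc (suc (suc a))) 2F = refl
    merged (suc (suc (suc a))) (suc (suc (suc b))) = refl

    det-loneElimination : det M₀ ≈ (x + 1#) * det Merged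
    det-loneElimination = begin
      det M₀    ≈⟨ det-addCol 3F 2F _ M₀ ⟨
      det M₁    ≈⟨ det-addRow 2F 2F _ M₁ ⟨
      det M₂    ≈⟨ det-singleEntryCol M₂ 3F 3F column₃ ⟩
      sign 3 * (sign 3 * (M₂ 3F 3F * det (minor 3F 3F M₂)))
        ≈⟨ *-congˡ (*-congˡ (*-cong pivot (det-cong merged))) ⟩
      sign 3 * (sign 3 * ((x + 1#) * det Merged))              ≈⟨ *-assoc _ _ _ ⟨
      (sign 3 * sign 3) * ((x + 1#) * det Merged)
        ≈⟨ trans (*-congʳ (sign-involutive 3)) (*-identityˡ _) ⟩
      (x + 1#) * det Merged                                    ∎

  detBlock : ℕ → List Block → Carrier
  detBlock n bs = det (toMat n (blockMatrix bs))

  det-absorbPairs : ∀ j k L m →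
    detBlock (suc (suc (j *ℕ 2 +ℕ m))) (pair k ∷ pairs j ++ L)
      ≈ pairFactor ^ j * detBlock (suc (suc m)) (pair (k +ℕ j) ∷ L)
  det-absorbPairs zero k L m = begin
    detBlock (suc (suc m)) (pair k ∷ L)
      ≡⟨ ≡.cong (λ z → detBlock (suc (suc m)) (pair z ∷ L)) (ℕ.+-identityʳ k) ⟨
    detBlock (suc (suc m)) (pair (k +ℕ 0) ∷ L)          ≈⟨ *-identityˡ _ ⟨
    1# * detBlock (suc (suc m)) (pair (k +ℕ 0) ∷ L)     ∎
  det-absorbPairs (suc j) k L m = begin
    detBlock (suc (suc (suc (suc (j *ℕ 2 +ℕ m))))) (pair k ∷ pair 0 ∷ pairs j ++ L)
      ≈⟨ PairElimination.det-pairElimination (j *ℕ 2 +ℕ m) k (pairs j ++ L) ⟩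
    pairFactor * detBlock (suc (suc (j *ℕ 2 +ℕ m))) (pair (suc k) ∷ pairs j ++ L)
      ≈⟨ *-congˡ (det-absorbPairs j (suc k) L m) ⟩
    pairFactor * (pairFactor ^ j * detBlock (suc (suc m)) (pair (suc k +ℕ j) ∷ L))
      ≈⟨ *-assoc _ _ _ ⟨
    pairFactor ^ suc j * detBlock (suc (suc m)) (pair (suc k +ℕ j) ∷ L)
      ≡⟨ ≡.cong (λ z → pairFactor ^ suc j * detBlock (suc (suc m)) (pair z ∷ L)) (ℕ.+-suc k j) ⟨
    pairFactor ^ suc j * detBlock (suc (suc m)) (pair (k +ℕ suc j) ∷ L) ∎

  det-absorbLones : ∀ j k m →
    detBlock (3 +ℕ j) (pair k ∷ lone m ∷ lones j) ≈ (x + 1#) ^ j * detBlock 3 (pair k ∷ lone (m +ℕ j) ∷ [])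
  det-absorbLones zero k m = begin
    detBlock 3 (pair k ∷ lone m ∷ [])
      ≡⟨ ≡.cong (λ z → detBlock 3 (pair k ∷ lone z ∷ [])) (ℕ.+-identityʳ m) ⟨
    detBlock 3 (pair k ∷ lone (m +ℕ 0) ∷ [])      ≈⟨ *-identityˡ _ ⟨
    1# * detBlock 3 (pair k ∷ lone (m +ℕ 0) ∷ []) ∎
  det-absorbLones (suc j) k m = begin
    detBlock (4 +ℕ j) (pair k ∷ lone m ∷ lone 0 ∷ lones j)
      ≈⟨ LoneElimination.det-loneElimination j k m (lones j) ⟩
    (x + 1#) * detBlock (3 +ℕ j) (pair k ∷ lone (suc m) ∷ lones j)
      ≈⟨ *-congˡ (det-absorbLones j k (suc m)) ⟩
    (x + 1#) * ((x + 1#) ^ j * detBlock 3 (pair k ∷ lone (suc m +ℕ j) ∷ []))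
      ≈⟨ *-assoc _ _ _ ⟨
    (x + 1#) ^ suc j * detBlock 3 (pair k ∷ lone (suc m +ℕ j) ∷ [])
      ≡⟨ ≡.cong (λ z → (x + 1#) ^ suc j * detBlock 3 (pair k ∷ lone z ∷ [])) (ℕ.+-suc m j) ⟨
    (x + 1#) ^ suc j * detBlock 3 (pair k ∷ lone (m +ℕ suc j) ∷ []) ∎

shape : ℕ → ℕ → List Block
shape t l = pairs t ++ lones l

-- The order anchor 0, its pendant, anchor 1, its pendant, …, then the l
-- clique vertices without pendant, as a listing of the vertices of K_(t+l)^t.
interleave : ℕ → ℕ → ℕ → ℕ
interleave zero    l u = u
interleave (suc t) l u = liftℕ (cycleℕ (t +ℕ l)) (liftℕ (liftℕ (interleave t l)) u)

shrink : ∀ {a} s t → suc (suc a) < suc s +ℕ suc t → a < s +ℕ t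
shrink {a} s t (s≤s p) = ℕ.≤-pred (≡.subst (suc (suc a) ≤_) (ℕ.+-suc s t) p)

kindAt-lones : ∀ l u → kindAt (lones l) u ≡ clique
kindAt-lones zero    u       = ≡.refl
kindAt-lones (suc l) zero    = ≡.refl
kindAt-lones (suc l) (suc u) = kindAt-lones l u

kindAt-shape : ∀ t l u → u < t +ℕ l +ℕ t → kindAt (shape t l) u ≡ kindOf (t +ℕ l) (interleave t l u)
kindAt-shape zero    l u             u<n = ≡.trans (kindAt-lones l u) (≡.sym (kindOf-clique (≡.subst (u <_) (ℕ.+-identityʳ l) u<n)))
kindAt-shape (suc t) l zero          _   = ≡.refl
kindAt-shape (suc t) l (suc zero)    _   = ≡.sym (kindOf-pendant {suc (t +ℕ l)} ℕ.≤-refl)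
kindAt-shape (suc t) l (suc (suc a)) u<n =
  ≡.trans (kindAt-shape t l a (shrink (t +ℕ l) t u<n)) (≡.sym (kindOf-embed (t +ℕ l) (interleave t l a)))

classSize-shape : ∀ t l u → classSize (shape t l) u ≡ 1
classSize-shape zero    zero    u             = ≡.refl
classSize-shape zero    (suc l) zero          = ≡.refl
classSize-shape zero    (suc l) (suc u)       = classSize-shape zero l u
classSize-shape (suc t) l       zero          = ≡.refl
classSize-shape (suc t) l       (suc zero)    = ≡.refl
classSize-shape (suc t) l       (suc (suc u)) = classSize-shape t l u

module Reordering {c ℓ : Level} (R : CommutativeRing c ℓ) (x : CommutativeRing.Carrier R) where
  open CommutativeRing R hiding (zero)
  open RingDefs R using (fromℕ; det)
  open IntegerCoefficients R
  open Determinants R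
  open BlockMatrices R x

  charEntry : ℕ → ℕ → ℕ → Carrier
  charEntry s u v = (if u ≡ᵇ v then x else 0#) - fromℕ (kDist s u v)

  rowSign-interleave : ∀ t l → Σ[ ε ∈ Carrier ] RowSign (t +ℕ l +ℕ t) (interleave t l) ε × ε * ε ≈ 1#
  rowSign-interleave zero    l = 1# , rowSign-id (l +ℕ 0) , *-identityˡ 1#
  rowSign-interleave (suc t) l with rowSign-interleave t l
  ... | ε , inner , ε²≈1 =
    ε * δ , rowSign-∘ (suc s +ℕ suc t) (liftℕ (cycleℕ s)) (liftℕ (liftℕ (interleave t l))) δ ε outer lifted , square
    where
    s = t +ℕ l
    δ = sign s
    lifted : RowSign (suc s +ℕ suc t) (liftℕ (liftℕ (interleave t l))) ε
    lifted = ≡.subst (λ n → RowSign n (liftℕ (liftℕ (interleave t l))) ε) (≡.cong suc (≡.sym (ℕ.+-suc s t)))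
               (rowSign-lift (suc (s +ℕ t)) (liftℕ (interleave t l)) ε (rowSign-lift (s +ℕ t) (interleave t l) ε inner))
    cyc : RowSign (s +ℕ suc t) (cycleℕ s) δ
    cyc = ≡.subst₂ (λ n k → RowSign n (cycleℕ k) (sign k)) (≡.sym (ℕ.+-suc s t)) (toℕ-fromℕ< _)
            (rowSign-cycle (s +ℕ t) (fromℕ< (s≤s (ℕ.m≤m+n s t))))
      where open import Data.Fin.Base using (fromℕ<)
            open import Data.Fin.Properties using (toℕ-fromℕ<)
    outer : RowSign (suc s +ℕ suc t) (liftℕ (cycleℕ s)) δ
    outer = rowSign-lift (s +ℕ suc t) (cycleℕ s) δ cyc
    square : (ε * δ) * (ε * δ) ≈ 1#
    square = trans (solve 2 (λ a b → (a :* b) :* (a :* b) := (a :* a) :* (b :* b)) refl ε δ)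
                   (trans (*-cong ε²≈1 (sign-involutive s)) (*-identityˡ 1#))

  kindDist≈fromℕ : ∀ a b → kindDist a b ≈ fromℕ (kindDistℕ a b)
  kindDist≈fromℕ clique  clique  = sym (+-identityʳ 1#)
  kindDist≈fromℕ clique  pendant = solve 0 (E1 :+ E1 := fN 2) refl
  kindDist≈fromℕ pendant clique  = solve 0 (E1 :+ E1 := fN 2) refl
  kindDist≈fromℕ pendant pendant = solve 0 (E1 :+ (E1 :+ E1) := fN 3) refl

  unitWeight : ∀ w → w ≡ 1 → ∀ d → fromℕ w * d ≈ d
  unitWeight _ ≡.refl d = trans (*-congʳ (+-identityʳ 1#)) (*-identityˡ d)

  charEntry-diag : ∀ s u → charEntry s u u ≈ x - 0#
  charEntry-diag s u = +-cong (reflexive (≡.cong (λ b → if b then x else 0#) (≡ᵇ-true {u} ≡.refl)))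
                              (-‿cong (reflexive (≡.cong fromℕ (kDist-refl s u))))

  charEntry-offDiag : ∀ s u v a b → kDist s u v ≡ kindDistℕ a b → charEntry s u v ≈ - kindDist a b
  charEntry-offDiag s u v a b d≡ = begin
    (if u ≡ᵇ v then x else 0#) - fromℕ (kDist s u v)
      ≈⟨ −-cong (reflexive (≡.cong (λ b → if b then x else 0#) (≡ᵇ-false u≢v)))
                                                                 (reflexive (≡.cong fromℕ d≡)) ⟩
    0# - fromℕ (kindDistℕ a b)                          ≈⟨ +-identityˡ _ ⟩
    - fromℕ (kindDistℕ a b)                             ≈⟨ -‿cong (kindDist≈fromℕ a b) ⟨
    - kindDist a b                                      ∎
    where
    open import Relation.Binary.Reasoning.Setoid setoid
    positive : ∀ a b → kindDistℕ a b ≢ 0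
    positive clique  clique  ()
    positive clique  pendant ()
    positive pendant clique  ()
    positive pendant pendant ()
    u≢v : u ≢ v
    u≢v ≡.refl = positive a b (≡.trans (≡.sym d≡) (kDist-refl s u))

  charEntry-weighted : ∀ s u v {a b a′ b′ w} → kDist s u v ≡ kindDistℕ a b → w ≡ 1 → a ≡ a′ → b ≡ b′ →
                       charEntry s u v ≈ - (fromℕ w * kindDist a′ b′)
  charEntry-weighted s u v {a} {b} d≡ ≡.refl ≡.refl ≡.refl =
    trans (charEntry-offDiag s u v a b d≡) (-‿cong (sym (unitWeight 1 ≡.refl (kindDist a b))))

  cliqueEntry : ℕ → ℕ → Carrier
  cliqueEntry u v = if u ≡ᵇ v then x - 0# else - 1#

  charEntry-clique : ∀ s u v → u < s → v < s → charEntry s u v ≈ cliqueEntry u v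
  charEntry-clique s u v u<s v<s with u ℕ.≟ v
  ... | yes ≡.refl = trans (charEntry-diag s u) (reflexive (≡.cong (λ b → if b then x - 0# else - 1#) (≡.sym (≡ᵇ-true {u} ≡.refl))))
  ... | no u≢v     = trans (charEntry-offDiag s u v clique clique (kDist-clique u<s v<s u≢v))
                           (reflexive (≡.cong (λ b → if b then x - 0# else - 1#) (≡.sym (≡ᵇ-false u≢v))))

  blockMatrix-lones : ∀ l u v → u < l → v < l → blockMatrix (lones l) u v ≈ cliqueEntry u v
  blockMatrix-lones (suc l) zero    zero    _         _         = refl
  blockMatrix-lones (suc l) zero    (suc v) _         _         =
    -‿cong (trans (unitWeight 1 ≡.refl _) (reflexive (≡.cong (kindDist clique) (kindAt-lones l v))))
  blockMatrix-lones (suc l) (suc u) zero    _         _         =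
    -‿cong (trans (unitWeight _ (classSize-shape zero l u) _) (reflexive (≡.cong (λ k → kindDist k clique) (kindAt-lones l u))))
  blockMatrix-lones (suc l) (suc u) (suc v) (s≤s u<l) (s≤s v<l) = blockMatrix-lones l u v u<l v<l

  charEntry-embed : ∀ s c d → charEntry (suc s) (embed s c) (embed s d) ≡ charEntry s c d
  charEntry-embed s c d = ≡.cong₂ (λ b k → (if b then x else 0#) - fromℕ k) same-test (kDist-embed s c d)
    where
    same-test : (embed s c ≡ᵇ embed s d) ≡ (c ≡ᵇ d)
    same-test with c ℕ.≟ d
    ... | yes ≡.refl = ≡.trans (≡ᵇ-true {embed s c} ≡.refl) (≡.sym (≡ᵇ-true {c} ≡.refl))
    ... | no c≢d     = ≡.trans (≡ᵇ-false (c≢d ∘ embed-injective s c d)) (≡.sym (≡ᵇ-false c≢d))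
      where open import Function.Base using (_∘_)

  charEntry-interleave : ∀ t l u v → u < t +ℕ l +ℕ t → v < t +ℕ l +ℕ t →
    charEntry (t +ℕ l) (interleave t l u) (interleave t l v) ≈ blockMatrix (shape t l) u v
  charEntry-interleave zero l u v u<n v<n =
    trans (charEntry-clique l u v u<l v<l) (sym (blockMatrix-lones l u v u<l v<l))
    where
    u<l = ≡.subst (u <_) (ℕ.+-identityʳ l) u<n
    v<l = ≡.subst (v <_) (ℕ.+-identityʳ l) v<n
  charEntry-interleave (suc t) l 0F 0F _ _ = refl
  charEntry-interleave (suc t) l 0F 1F _ _ =
    trans (charEntry-offDiag (suc (t +ℕ l)) 0 (suc (t +ℕ l)) clique clique (kDist-anchor-pendant (t +ℕ l)))
          (solve 0 (:- E1 := :- (E1 :+ E0 :* T2)) refl)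
  charEntry-interleave (suc t) l 1F 0F _ _ =
    trans (charEntry-offDiag (suc (t +ℕ l)) (suc (t +ℕ l)) 0 clique clique (kDist-pendant-anchor (t +ℕ l)))
          (solve 0 (:- E1 := :- (E1 :+ E0 :* T2)) refl)
  charEntry-interleave (suc t) l 1F 1F _ _ =
    trans (charEntry-diag (suc (t +ℕ l)) (suc (t +ℕ l))) (solve 1 (λ y → y :- E0 := y :- E0 :* T3) refl x)
  charEntry-interleave (suc t) l 0F (suc (suc b)) _ v<n =
    charEntry-weighted (suc s) 0 (embed s π) (kDist-anchor-embed s π) ≡.refl ≡.refl
      (≡.sym (kindAt-shape t l b (shrink s t v<n)))
    where
    s = t +ℕ l
    π = interleave t l b
  charEntry-interleave (suc t) l 1F (suc (suc b)) _ v<n =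
    charEntry-weighted (suc s) (suc s) (embed s π) (kDist-pendant-embed s π) ≡.refl ≡.refl
      (≡.sym (kindAt-shape t l b (shrink s t v<n)))
    where
    s = t +ℕ l
    π = interleave t l b
  charEntry-interleave (suc t) l (suc (suc a)) 0F u<n _ =
    charEntry-weighted (suc s) (embed s π) 0 (kDist-embed-anchor s π) (classSize-shape t l a)
      (≡.sym (kindAt-shape t l a (shrink s t u<n))) ≡.refl
    where
    s = t +ℕ l
    π = interleave t l a
  charEntry-interleave (suc t) l (suc (suc a)) 1F u<n _ =
    charEntry-weighted (suc s) (embed s π) (suc s) (kDist-embed-pendant s π) (classSize-shape t l a)
      (≡.sym (kindAt-shape t l a (shrink s t u<n))) ≡.refl
    where
    s = t +ℕ l
    π = interleave t l a
  charEntry-interleave (suc t) l (suc (suc a)) (suc (suc b)) u<n v<n =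
    trans (reflexive (charEntry-embed (t +ℕ l) (interleave t l a) (interleave t l b)))
          (charEntry-interleave t l a b (shrink (t +ℕ l) t u<n) (shrink (t +ℕ l) t v<n))

  det-reorder : ∀ t l → det (toMat (t +ℕ l +ℕ t) (charEntry (t +ℕ l))) ≈ detBlock (t +ℕ l +ℕ t) (shape t l)
  det-reorder t l with rowSign-interleave t l
  ... | ε , π-sign , ε²≈1 =
    trans (sym (det-conjugate (t +ℕ l +ℕ t) (interleave t l) ε π-sign ε²≈1 (charEntry (t +ℕ l))))
          (det-cong (λ i j → charEntry-interleave t l (toℕ i) (toℕ j) (toℕ<n i) (toℕ<n j)))
    where
    open import Data.Fin.Base using (toℕ)
    open import Data.Fin.Properties using (toℕ<n)

isYes-≟ : ∀ {n} (i j : Fin n) → isYes (i ≟ j) ≡.≡ (toℕ i ≡ᵇ toℕ j)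
isYes-≟ i j with i ≟ j
... | yes ≡.refl = ≡.sym (≡ᵇ-true {toℕ i} ≡.refl)
... | no i≢j     = ≡.sym (≡ᵇ-false (λ e → i≢j (toℕ-injective e)))

splitGap : ∀ {t s} → t +ℕ 1 ≤ s → ∃ λ o → s ≡.≡ t +ℕ suc o
splitGap {t} t+1≤s with ℕ.m≤n⇒∃[o]m+o≡n t+1≤s
... | o , e = o , ≡.trans (≡.sym e) (ℕ.+-assoc t 1 o)

module CharacteristicPolynomial {c ℓ : Level} (R : CommutativeRing c ℓ) (x : CommutativeRing.Carrier R) where
  open CommutativeRing R hiding (zero)
  open RingDefs R
  open IntegerCoefficients R
  open Determinants R
  open BlockMatrices R x
  open Reordering R x
  open import Relation.Binary.Reasoning.Setoid setoid

  quadratic : ℕ → Carrier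
  quadratic t = x ^ 2 + (fromℕ 4 - fromℕ (4 *ℕ t)) * x + (fromℕ 2 - fromℕ (2 *ℕ t) - fromℕ (t *ℕ t))

  cubic : ℕ → ℕ → Carrier
  cubic s t =
    x ^ 3 + (fromℕ 5 - fromℕ s - fromℕ (3 *ℕ t)) * x ^ 2
          + (fromℕ 6 - fromℕ (4 *ℕ s) - fromℕ (2 *ℕ t) - fromℕ (s *ℕ t)) * x
          + (fromℕ 2 - fromℕ (2 *ℕ s) - fromℕ (s *ℕ t))

  charPoly-DK : ∀ s t → t ≤ s → 2 ≤ t → charPoly (DK s t) x ≈ det (toMat (s +ℕ t) (charEntry s))
  charPoly-DK s t t≤s 2≤t = det-cong λ i j →
    +-cong (reflexive (≡.cong (λ b → if b then x else 0#) (isYes-≟ i j)))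
           (-‿cong (reflexive (≡.cong fromℕ (PendantGraph.DK≡kDist s t t≤s 2≤t i j))))

  charPoly-blocks : ∀ k l → charPoly (DK (suc (suc k) +ℕ l) (suc (suc k))) x
                              ≈ pairFactor ^ suc k * detBlock (2 +ℕ l) (pair (suc k) ∷ lones l)
  charPoly-blocks k l = begin
    charPoly (DK s t) x                                    ≈⟨ charPoly-DK s t (ℕ.m≤m+n t l) (s≤s (s≤s z≤n)) ⟩
    det (toMat (s +ℕ t) (charEntry s))                     ≈⟨ det-reorder t l ⟩
    detBlock (s +ℕ t) (shape t l)                          ≡⟨ ≡.cong (λ n → detBlock n (shape t l)) size ⟩
    detBlock (2 +ℕ (suc k *ℕ 2 +ℕ l)) (pair 0 ∷ pairs (suc k) ++ lones l)
                                                           ≈⟨ det-absorbPairs (suc k) 0 (lones l) l ⟩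
    pairFactor ^ suc k * detBlock (2 +ℕ l) (pair (suc k) ∷ lones l) ∎
    where
    open import Data.List.Base using (_++_)
    open import Data.Nat.Tactic.RingSolver using (solve-∀)
    t = suc (suc k)
    s = t +ℕ l
    size-eq : ∀ k l → suc (suc k) +ℕ l +ℕ suc (suc k) ≡.≡ 2 +ℕ (suc k *ℕ 2 +ℕ l)
    size-eq = solve-∀
    size : s +ℕ t ≡.≡ 2 +ℕ (suc k *ℕ 2 +ℕ l)
    size = size-eq k l

  quadratic-expand : ∀ t → quadratic t ≈
    x ^ 2 + (fromℕ 4 - fromℕ 4 * fromℕ t) * x + (fromℕ 2 - fromℕ 2 * fromℕ t - fromℕ t * fromℕ t)
  quadratic-expand t =
    +-cong (+-congˡ (*-congʳ (−-cong refl (fromℕ-homo-* 4 t))))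
           (−-cong (−-cong refl (fromℕ-homo-* 2 t)) (fromℕ-homo-* t t))

  cubic-expand : ∀ s t → cubic s t ≈
    x ^ 3 + (fromℕ 5 - fromℕ s - fromℕ 3 * fromℕ t) * x ^ 2
          + (fromℕ 6 - fromℕ 4 * fromℕ s - fromℕ 2 * fromℕ t - fromℕ s * fromℕ t) * x
          + (fromℕ 2 - fromℕ 2 * fromℕ s - fromℕ s * fromℕ t)
  cubic-expand s t =
    +-cong (+-cong (+-congˡ (*-congʳ (−-cong refl (fromℕ-homo-* 3 t))))
                   (*-congʳ (−-cong (−-cong (−-cong refl (fromℕ-homo-* 4 s)) (fromℕ-homo-* 2 t)) (fromℕ-homo-* s t))))
           (−-cong (−-cong refl (fromℕ-homo-* 2 s)) (fromℕ-homo-* s t))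

  detBlock-quadratic : ∀ k → detBlock 2 (pair k ∷ []) ≈ quadratic (suc k)
  detBlock-quadratic k = begin
    detBlock 2 (pair k ∷ [])      ≈⟨ det₂ (toMat 2 (blockMatrix (pair k ∷ []))) ⟩
    (x - f) * (x - f * three) - (- (1# + f * two)) * (- (1# + f * two))
      ≈⟨ solve 2 (λ y f →
           (y :- f) :* (y :- f :* T3) :- (:- (E1 :+ f :* T2)) :* (:- (E1 :+ f :* T2))
           := y :* (y :* E1) :+ (fN 4 :- fN 4 :* (E1 :+ f)) :* y
              :+ (fN 2 :- fN 2 :* (E1 :+ f) :- (E1 :+ f) :* (E1 :+ f))) refl x f ⟩
    x ^ 2 + (fromℕ 4 - fromℕ 4 * fromℕ (suc k)) * x
      + (fromℕ 2 - fromℕ 2 * fromℕ (suc k) - fromℕ (suc k) * fromℕ (suc k))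
                                  ≈⟨ quadratic-expand (suc k) ⟨
    quadratic (suc k)             ∎
    where f = fromℕ k

  detBlock-cubic : ∀ k m → detBlock 3 (pair k ∷ lone m ∷ []) ≈ cubic (suc k +ℕ suc m) (suc k)
  detBlock-cubic k m = begin
    detBlock 3 (pair k ∷ lone m ∷ [])   ≈⟨ det₃ (toMat 3 (blockMatrix (pair k ∷ lone m ∷ []))) ⟩
    (x - f) * ((x - f * three) * (x - g) - (- ((1# + f) * two)) * (- ((1# + g) * two)))
    - (- (1# + f * two)) * ((- (1# + f * two)) * (x - g) - (- ((1# + f) * two)) * (- ((1# + g) * 1#)))
    + (- ((1# + f) * 1#)) * ((- (1# + f * two)) * (- ((1# + g) * two)) - (x - f * three) * (- ((1# + g) * 1#)))
      ≈⟨ solve 3 (λ y f g →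
           (y :- f) :* ((y :- f :* T3) :* (y :- g) :- (:- ((E1 :+ f) :* T2)) :* (:- ((E1 :+ g) :* T2)))
           :- (:- (E1 :+ f :* T2)) :* ((:- (E1 :+ f :* T2)) :* (y :- g) :- (:- ((E1 :+ f) :* T2)) :* (:- ((E1 :+ g) :* E1)))
           :+ (:- ((E1 :+ f) :* E1)) :* ((:- (E1 :+ f :* T2)) :* (:- ((E1 :+ g) :* T2)) :- (y :- f :* T3) :* (:- ((E1 :+ g) :* E1)))
           := y :* (y :* (y :* E1)) :+ (fN 5 :- ((E1 :+ f) :+ (E1 :+ g)) :- fN 3 :* (E1 :+ f)) :* (y :* (y :* E1))
              :+ (fN 6 :- fN 4 :* ((E1 :+ f) :+ (E1 :+ g)) :- fN 2 :* (E1 :+ f) :- ((E1 :+ f) :+ (E1 :+ g)) :* (E1 :+ f)) :* y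
              :+ (fN 2 :- fN 2 :* ((E1 :+ f) :+ (E1 :+ g)) :- ((E1 :+ f) :+ (E1 :+ g)) :* (E1 :+ f))) refl x f g ⟩
    x ^ 3 + (fromℕ 5 - S - fromℕ 3 * T) * x ^ 2 + (fromℕ 6 - fromℕ 4 * S - fromℕ 2 * T - S * T) * x
      + (fromℕ 2 - fromℕ 2 * S - S * T)
      ≈⟨ +-cong (+-cong (+-congˡ (*-congʳ (−-cong (−-cong refl s≈S) refl)))
                        (*-congʳ (−-cong (−-cong (−-cong refl (*-congˡ s≈S)) refl) (*-congʳ s≈S))))
                (−-cong (−-cong refl (*-congˡ s≈S)) (*-congʳ s≈S)) ⟨
    x ^ 3 + (fromℕ 5 - fromℕ s - fromℕ 3 * T) * x ^ 2 + (fromℕ 6 - fromℕ 4 * fromℕ s - fromℕ 2 * T - fromℕ s * T) * x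
      + (fromℕ 2 - fromℕ 2 * fromℕ s - fromℕ s * T)
      ≈⟨ cubic-expand s (suc k) ⟨
    cubic s (suc k)                     ∎
    where
    f = fromℕ k
    g = fromℕ m
    s = suc k +ℕ suc m
    S = (1# + f) + (1# + g)
    T = 1# + f
    s≈S : fromℕ s ≈ S
    s≈S = fromℕ-homo-+ (suc k) (suc m)

  module _ (r : Carrier) (r²≈2 : r * r ≈ fromℕ 2) where

    pairFactor-split : ∀ k → pairFactor ^ k ≈ (x + fromℕ 2 - r) ^ k * (x + fromℕ 2 + r) ^ k
    pairFactor-split zero    = sym (*-identityˡ 1#)
    pairFactor-split (suc k) = begin
      pairFactor * pairFactor ^ k                    ≈⟨ *-cong split (pairFactor-split k) ⟩
      (a * b) * (a ^ k * b ^ k)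
        ≈⟨ solve 4 (λ a b c d → (a :* b) :* (c :* d) := (a :* c) :* (b :* d)) refl a b (a ^ k) (b ^ k) ⟩
      (a * a ^ k) * (b * b ^ k)                      ∎
      where
      a = x + fromℕ 2 - r
      b = x + fromℕ 2 + r
      split : pairFactor ≈ a * b
      split = begin
        pairFactor                                   ≈⟨ +-identityʳ _ ⟨
        pairFactor + 0#                              ≈⟨ +-congˡ (-‿inverseʳ (fromℕ 2)) ⟨
        pairFactor + (fromℕ 2 - fromℕ 2)             ≈⟨ +-congˡ (−-cong refl r²≈2) ⟨
        pairFactor + (fromℕ 2 - r * r)
          ≈⟨ solve 2 (λ y r → (y :* y :+ fN 4 :* y :+ fN 2) :+ (fN 2 :- r :* r)
                              := (y :+ fN 2 :- r) :* (y :+ fN 2 :+ r)) refl x r ⟩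
        a * b                                        ∎

    charPoly-K-equal : ∀ t → 2 ≤ t →
      charPoly (DK t t) x ≈ (x + fromℕ 2 - r) ^ (t ∸ 1) * (x + fromℕ 2 + r) ^ (t ∸ 1) * quadratic t
    charPoly-K-equal (suc (suc k)) (s≤s (s≤s z≤n)) = begin
      charPoly (DK t t) x
        ≡⟨ ≡.cong (λ s → charPoly (DK s t) x) (ℕ.+-identityʳ t) ⟨
      charPoly (DK (t +ℕ 0) t) x                                 ≈⟨ charPoly-blocks k 0 ⟩
      pairFactor ^ suc k * detBlock 2 (pair (suc k) ∷ [])
        ≈⟨ *-cong (pairFactor-split (suc k)) (detBlock-quadratic (suc k)) ⟩
      (x + fromℕ 2 - r) ^ suc k * (x + fromℕ 2 + r) ^ suc k * quadratic t ∎
      where t = suc (suc k)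

    charPoly-K-gap : ∀ s t → 2 ≤ t → t +ℕ 1 ≤ s →
      charPoly (DK s t) x ≈ (x + 1#) ^ (s ∸ t ∸ 1) * (x + fromℕ 2 - r) ^ (t ∸ 1) * (x + fromℕ 2 + r) ^ (t ∸ 1) * cubic s t
    charPoly-K-gap s (suc (suc k)) (s≤s (s≤s z≤n)) t+1≤s with splitGap {suc (suc k)} t+1≤s
    ... | o , ≡.refl = begin
      charPoly (DK (t +ℕ suc o) t) x                                        ≈⟨ charPoly-blocks k (suc o) ⟩
      pairFactor ^ suc k * detBlock (3 +ℕ o) (pair (suc k) ∷ lone 0 ∷ lones o)
                                                                            ≈⟨ *-congˡ (det-absorbLones o (suc k) 0) ⟩
      pairFactor ^ suc k * ((x + 1#) ^ o * detBlock 3 (pair (suc k) ∷ lone o ∷ []))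
        ≈⟨ *-cong (pairFactor-split (suc k)) (*-congˡ (detBlock-cubic (suc k) o)) ⟩
      (a ^ suc k * b ^ suc k) * ((x + 1#) ^ o * cubic (t +ℕ suc o) t)
        ≈⟨ solve 4 (λ a b c d → (a :* b) :* (c :* d) := c :* a :* b :* d) refl
                   (a ^ suc k) (b ^ suc k) ((x + 1#) ^ o) (cubic (t +ℕ suc o) t) ⟩
      (x + 1#) ^ o * a ^ suc k * b ^ suc k * cubic (t +ℕ suc o) t
        ≡⟨ ≡.cong (λ e → (x + 1#) ^ e * a ^ suc k * b ^ suc k * cubic (t +ℕ suc o) t) gap ⟨
      (x + 1#) ^ (t +ℕ suc o ∸ t ∸ 1) * a ^ suc k * b ^ suc k * cubic (t +ℕ suc o) t ∎
      where
      t = suc (suc k)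
      a = x + fromℕ 2 - r
      b = x + fromℕ 2 + r
      gap : t +ℕ suc o ∸ t ∸ 1 ≡.≡ o
      gap = ≡.cong (_∸ 1) (ℕ.m+n∸m≡n t (suc o))

lemma3p1 : ∀ {c ℓ : Level} (R : CommutativeRing c ℓ) (s t : ℕ) → 2 ≤ t → t ≤ s →
  let open CommutativeRing R
      open RingDefs R
  in (x r : Carrier) → r * r ≈ fromℕ 2 →
     ((t +ℕ 1 ≤ s →
       charPoly (DK s t) x ≈
         (x + 1#) ^ (s ∸ t ∸ 1)
         * (x + fromℕ 2 - r) ^ (t ∸ 1)
         * (x + fromℕ 2 + r) ^ (t ∸ 1)
         * (x ^ 3
            + (fromℕ 5 - fromℕ s - fromℕ (3 *ℕ t)) * x ^ 2
            + (fromℕ 6 - fromℕ (4 *ℕ s) - fromℕ (2 *ℕ t) - fromℕ (s *ℕ t)) * x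
            + (fromℕ 2 - fromℕ (2 *ℕ s) - fromℕ (s *ℕ t))))
     × (s ≡ t →
       charPoly (DK s t) x ≈
         (x + fromℕ 2 - r) ^ (t ∸ 1)
         * (x + fromℕ 2 + r) ^ (t ∸ 1)
         * (x ^ 2
            + (fromℕ 4 - fromℕ (4 *ℕ t)) * x
            + (fromℕ 2 - fromℕ (2 *ℕ t) - fromℕ (t *ℕ t)))))
-- t ≤ s is implied by the hypothesis of either case.
lemma3p1 R s t 2≤t _ x r r²≈2 =
  charPoly-K-gap r r²≈2 s t 2≤t , λ { ≡.refl → charPoly-K-equal r r²≈2 t 2≤t }
  where open CharacteristicPolynomial R x
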